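{- For every pair of reactive Turing machines $M_1$ and $M_2$ and every set of communication channels $C$ there is a reactive Turing machine $M$ such that $\mathcal{T}(M)\leftrightarrow_b^\Delta\mathcal{T}([M_1\parallel M_2]_C)$.
   Context: Fix a finite set $\mathcal{A}$ of action symbols and $\tau\notin\mathcal{A}$; $\mathcal{A}_\tau=\mathcal{A}\cup\{\tau\}$. Fix a finite set $\mathcal{D}$ of data symbols and a blank $\Box\notin\mathcal{D}$; $\mathcal{D}_\Box=\mathcal{D}\cup\{\Box\}$. Fix a finite set $\mathit{Chan}$ of channels; $\mathcal{A}$ contains the actions $c!d$ (send $d$ on $c$) and $c?d$ (receive $d$ on $c$) for $c\in\mathit{Chan}$, $d\in\mathcal{D}_\Box$; $C$ ranges over subsets of $\mathit{Chan}$. A transition system is $T=(S,\to,\uparrow,\downarrow)$ with $\to\subseteq S\times\mathcal{A}_\tau\times S$, initial state $\uparrow$, final states $\downarrow\subseteq S$. The parallel composition $[T_1\parallel T_2]_C$ of $T_i=(S_i,\to_i,\uparrow_i,\downarrow_i)$ has states $S_1\times S_2$, initial state $(\uparrow_1,\uparrow_2)$, final states $\downarrow_1\times\downarrow_2$, and $(s_1,s_2)\xrightarrow{a}(s_1',s_2')$ iff $a\notin\{c!d,c?d\mid c\in C,d\in\mathcal{D}_\Box\}$ and either (a) $s_1\xrightarrow{a}_1s_1'$ and $s_2=s_2'$, or $s_2\xrightarrow{a}_2s_2'$ and $s_1=s_1'$; or (b) $a=\tau$ and, for some $c\in C$, $d\in\mathcal{D}_\Box$, $s_1\xrightarrow{c!d}_1s_1'$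 and $s_2\xrightarrow{c?d}_2s_2'$, or $s_1\xrightarrow{c?d}_1s_1'$ and $s_2\xrightarrow{c!d}_2s_2'$. A reactive Turing machine (RTM) is $M=(S,\to,\uparrow,\downarrow)$ with $S$ finite, $\uparrow\in S$, $\downarrow\subseteq S$, $\to\subseteq S\times\mathcal{D}_\Box\times\mathcal{A}_\tau\times\mathcal{D}_\Box\times\{L,R\}\times S$ (write $s\xrightarrow{d/a/e,X}t$). A tape instance is a finite sequence over $\mathcal{D}_\Box$ and marked symbols $\check d$ with exactly one marked symbol, identified modulo blanks at the ends; for $\delta\in\mathcal{D}_\Box^*$, $\overleftarrow{\delta}$ (resp. $\overrightarrow{\delta}$) is $\delta$ with rightmost (resp. leftmost) symbol marked, or $\check\Box$ if $\delta$ is empty. $\mathcal{T}(M)$ has states the configurations $(s,\delta)$, transitions $(s,\delta_L\check d\delta_R)\xrightarrow{a}(t,\overleftarrow{\delta_L}e\delta_R)$ iff $s\xrightarrow{d/a/e,L}t$ and $(s,\delta_L\check d\delta_R)\xrightarrow{a}(t,\delta_Le\overrightarrow{\delta_R})$ iff $s\xrightarrow{d/a/e,R}t$, initial state $(\uparrow,\check\Box)$, final states $\{(s,\delta)\mid s\in\downarrow\}$. The transition system of the parallel composition of RTMs is $\mathcal{T}([M_1\parallel M_2]_C)=[\mathcal{T}(M_1)\parallel\mathcal{T}(M_2)]_C$. Divergence-preserving branching bisimilarity: write $s\xrightarrow{(a)}t$ if $s\xrightarrow{a}t$, or $a=\tau$ and $s=t$; $\twoheadrightarrow$ / $\twoheadrightarrow^+$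 are the reflexive-transitive / transitive closures of $\xrightarrow{\tau}$. A relation $\mathcal{R}$ is a divergence-preserving branching bisimulation from $T_1$ to $T_2$ if $s_1\mathcal{R}s_2$ implies: (1) if $s_1\xrightarrow{a}s_1'$ then $s_2\twoheadrightarrow s_2''\xrightarrow{(a)}s_2'$ with $s_1\mathcal{R}s_2''$, $s_1'\mathcal{R}s_2'$; (2) symmetrically; (3) if $s_1$ final then $s_2\twoheadrightarrow s_2'$, $s_2'$ final, $s_1\mathcal{R}s_2'$; (4) symmetrically; (5) if $s_1=s_{1,0}\xrightarrow{\tau}s_{1,1}\xrightarrow{\tau}\cdots$ is infinite with all $s_{1,i}\mathcal{R}s_2$ then $s_2\twoheadrightarrow^+s_2'$ with $s_{1,i}\mathcal{R}s_2'$ for some $i$; (6) symmetrically. $T_1\leftrightarrow_b^\Delta T_2$ if such a relation relates the initial states. -}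

module Defs where

open import Data.Nat using (ℕ; zero; suc)
open import Data.Fin using (Fin)
open import Data.Fin.Subset using (Subset; _∈_)
open import Data.Bool using (Bool; true; false)
open import Data.Maybe using (Maybe; just; nothing)
open import Data.List using (List; []; _∷_)
open import Data.Product using (Σ; ∃; _×_; _,_)
open import Data.Sum using (_⊎_)
open import Data.Empty using (⊥)
open import Relation.Binary.PropositionalEquality using (_≡_)
open import Relation.Nullary using (¬_)
open import Relation.Binary.Construct.Closure.ReflexiveTransitive using (Star)
open import Relation.Binary.Construct.Closure.Transitive using (TransClosure)

module Params (nA nD nCh : ℕ) where

  Data : Set
  Data = Fin nD

  DBox : Set
  DBox = Maybe Data

  □ : DBox
  □ = nothing

  Chan : Set
  Chan = Fin nCh

  data Act : Set where
    act : Fin nA → Act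
    _!_ : Chan → DBox → Act
    _⁇_ : Chan → DBox → Act

  data Actτ : Set where
    τ : Actτ
    ⌜_⌝ : Act → Actτ

  record TS : Set₁ where
    field
      State : Set
      _⟶[_]_ : State → Actτ → State → Set
      initial : State
      Final : State → Set

  Restricted : Subset nCh → Actτ → Set
  Restricted C τ = ⊥
  Restricted C ⌜ act _ ⌝ = ⊥
  Restricted C ⌜ c ! d ⌝ = c ∈ C
  Restricted C ⌜ c ⁇ d ⌝ = c ∈ C

  module _ (C : Subset nCh) (T₁ T₂ : TS) where
    private
      module T₁ = TS T₁
      module T₂ = TS T₂

    data ParStep : T₁.State × T₂.State → Actτ → T₁.State × T₂.State → Set where
      left  : ∀ {a s₁ s₁' s₂} → ¬ Restricted C a → s₁ T₁.⟶[ a ] s₁' →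
              ParStep (s₁ , s₂) a (s₁' , s₂)
      right : ∀ {a s₁ s₂ s₂'} → ¬ Restricted C a → s₂ T₂.⟶[ a ] s₂' →
              ParStep (s₁ , s₂) a (s₁ , s₂')
      comm!? : ∀ {c d s₁ s₁' s₂ s₂'} → c ∈ C →
              s₁ T₁.⟶[ ⌜ c ! d ⌝ ] s₁' → s₂ T₂.⟶[ ⌜ c ⁇ d ⌝ ] s₂' →
              ParStep (s₁ , s₂) τ (s₁' , s₂')
      comm?! : ∀ {c d s₁ s₁' s₂ s₂'} → c ∈ C →
              s₁ T₁.⟶[ ⌜ c ⁇ d ⌝ ] s₁' → s₂ T₂.⟶[ ⌜ c ! d ⌝ ] s₂' →
              ParStep (s₁ , s₂) τ (s₁' , s₂')

    Par : TS
    Par = record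
      { State = T₁.State × T₂.State
      ; _⟶[_]_ = ParStep
      ; initial = (T₁.initial , T₂.initial)
      ; Final = λ { (s₁ , s₂) → T₁.Final s₁ × T₂.Final s₂ }
      }

  data Dir : Set where
    L R : Dir

  record RTM : Set where
    field
      nStates : ℕ
      init    : Fin nStates
      final   : Fin nStates → Bool
      -- the finite transition relation s --d/a/e,X--> t, as a Boolean predicate
      trans   : Fin nStates → DBox → Actτ → DBox → Dir → Fin nStates → Bool

  -- Canonical representation of one side of a tape, modulo blanks at
  -- the end: nothing = empty (all blanks); just (xs , d) = the cells
  -- xs (listed outward from the head) followed by a final non-blank d.
  Side : Set
  Side = Maybe (List DBox × Data)

  push : DBox → Side → Side
  push nothing  nothing         = nothing
  push (just d) nothing         = just ([] , d)
  push e        (just (xs , d)) = just (e ∷ xs , d)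

  pop : Side → DBox × Side
  pop nothing                = (nothing , nothing)
  pop (just ([] , d))        = (just d , nothing)
  pop (just (x ∷ xs , d))    = (x , just (xs , d))

  -- tape instance δ_L ď δ_R : (left side read outward, head symbol, right side)
  Tape : Set
  Tape = Side × DBox × Side

  emptyTape : Tape
  emptyTape = (nothing , nothing , nothing)

  module _ (M : RTM) where
    open RTM M

    Config : Set
    Config = Fin nStates × Tape

    data RTMStep : Config → Actτ → Config → Set where
      stepL : ∀ {s d a e t l r} → trans s d a e L t ≡ true →
              let (h , l') = pop l in
              RTMStep (s , (l , d , r)) a (t , (l' , h , push e r))
      stepR : ∀ {s d a e t l r} → trans s d a e R t ≡ true →
              let (h , r') = pop r in
              RTMStep (s , (l , d , r)) a (t , (push e l , h , r'))

    𝒯 : TS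
    𝒯 = record
      { State = Config
      ; _⟶[_]_ = RTMStep
      ; initial = (init , emptyTape)
      ; Final = λ { (s , _) → final s ≡ true }
      }

  𝒯Par : Subset nCh → RTM → RTM → TS
  𝒯Par C M₁ M₂ = Par C (𝒯 M₁) (𝒯 M₂)

  module _ (T₁ T₂ : TS) where
    private
      module T₁ = TS T₁
      module T₂ = TS T₂

    τ₂ : T₂.State → T₂.State → Set
    τ₂ s t = s T₂.⟶[ τ ] t

    _↠₂_ : T₂.State → T₂.State → Set
    _↠₂_ = Star τ₂

    _↠⁺₂_ : T₂.State → T₂.State → Set
    _↠⁺₂_ = TransClosure τ₂

    _⟶₂⟨_⟩_ : T₂.State → Actτ → T₂.State → Set
    s ⟶₂⟨ a ⟩ t = s T₂.⟶[ a ] t ⊎ (a ≡ τ × s ≡ t)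

    record HalfBisim (R : T₁.State → T₂.State → Set) : Set where
      field
        step : ∀ {s₁ s₂ a s₁'} → R s₁ s₂ → s₁ T₁.⟶[ a ] s₁' →
               ∃ λ s₂'' → ∃ λ s₂' → s₂ ↠₂ s₂'' × s₂'' ⟶₂⟨ a ⟩ s₂' × R s₁ s₂'' × R s₁' s₂'
        final : ∀ {s₁ s₂} → R s₁ s₂ → T₁.Final s₁ →
               ∃ λ s₂' → s₂ ↠₂ s₂' × T₂.Final s₂' × R s₁ s₂'
        diverge : ∀ {s₁ s₂} → R s₁ s₂ → (f : ℕ → T₁.State) → f zero ≡ s₁ →
               (∀ i → f i T₁.⟶[ τ ] f (suc i)) → (∀ i → R (f i) s₂) →
               ∃ λ s₂' → s₂ ↠⁺₂ s₂' × ∃ λ i → R (f i) s₂'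

  flipR : {A B : Set} → (A → B → Set) → B → A → Set
  flipR Rel b a = Rel a b

  record IsDPBB (T₁ T₂ : TS) (R : TS.State T₁ → TS.State T₂ → Set) : Set where
    field
      forth : HalfBisim T₁ T₂ R
      back  : HalfBisim T₂ T₁ (flipR R)

  _↔bΔ_ : TS → TS → Set₁
  T₁ ↔bΔ T₂ = Σ (TS.State T₁ → TS.State T₂ → Set) λ R →
              IsDPBB T₁ T₂ R × R (TS.initial T₁) (TS.initial T₂)

module Submission where

-- If 𝒟 = ∅ all tapes stay blank and the product of the two finite controls is
-- a strong bisimulation (module BlankTapes).  Otherwise a data symbol 𝟙 acts
-- as a marker: the simulator stores the two tapes in blocks of four cells
-- (cell k of tape 1, cell k of tape 2, and two cells marking the heads' blocks;
-- module Layouts) and keeps both control states, both head symbols and the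
-- order of the heads in its finite control.  A ready state performs a step of
-- the composition, chosen from a finite description of its moves (module
-- JointMoves), in one visible step; a deterministic, terminating run of
-- τ-steps then realises it on the tape and returns to a ready state (module
-- Simulator).  Relating each configuration to the one encoded by the ready
-- state its bookkeeping leads to is a divergence-preserving branching
-- bisimulation (module Bisimulation); corollary3 combines the two cases.

open import Defs
open import Data.Nat as ℕ using (ℕ; zero; suc)
open import Data.Integer as ℤ using (ℤ; +_; -[1+_]; +0)
import Data.Integer.Properties as ℤP
import Data.Nat.Properties as ℕP
open import Data.Integer.Tactic.RingSolver using (solve-∀)
open import Data.Fin as F using (Fin; zero; suc; toℕ; #_)
import Data.Fin.Properties as FP
open import Data.Fin.Subset using (Subset; _∈_)
open import Data.Fin.Subset.Properties using (_∈?_)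
open import Data.Vec using (Vec; []; _∷_; lookup)
open import Data.Bool using (Bool; true; false; if_then_else_; _∧_; _∨_; not)
import Data.Bool.Properties as BP
open import Data.Maybe using (Maybe; just; nothing)
import Data.Maybe.Properties as MP
open import Data.Product using (Σ; ∃; _×_; _,_; proj₁; proj₂)
open import Data.Sum using (_⊎_; inj₁; inj₂)
open import Data.Empty using (⊥-elim)
open import Function.Bundles using (mk⇔)
open import Algebra.Bundles using (AbelianGroup)
import Algebra.Properties.Group as GroupProperties
open import Relation.Nullary using (¬_; Dec; yes; no; does)
open import Relation.Nullary.Decidable using (_×-dec_; _⊎-dec_; ¬?; dec-true; dec-false; does-⇔)
open import Relation.Binary.Definitions using (tri<; tri≈; tri>)
open import Relation.Binary.PropositionalEquality
open import Relation.Binary.Construct.Closure.ReflexiveTransitive using (Star; ε; _◅_; _◅◅_)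
open import Relation.Binary.Construct.Closure.Transitive using (TransClosure; [_]; _∷_)

-- This is what turns
-- the structured control states of the simulator into the states Fin n of an
-- RTM, and what makes existential statements over them decidable.
record Finite (A : Set) : Set where
  field
    size    : ℕ
    to      : A → Fin size
    from    : Fin size → A
    from-to : ∀ a → from (to a) ≡ a

module Finiteness where
  open Finite

  finFin : ∀ n → Finite (Fin n)
  finFin n = record { size = n ; to = λ x → x ; from = λ x → x ; from-to = λ _ → refl }

  finMaybe : ∀ {A} → Finite A → Finite (Maybe A)
  finMaybe FA = record { size = suc (size FA) ; to = t ; from = f ; from-to = ft }
    where
    t : _ → Fin (suc (size FA))
    t nothing  = zero
    t (just a) = suc (to FA a)
    f : Fin (suc (size FA)) → _
    f zero    = nothing
    f (suc i) = just (from FA i)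
    ft : ∀ a → f (t a) ≡ a
    ft nothing  = refl
    ft (just a) = cong just (from-to FA a)

  finProd : ∀ {A B} → Finite A → Finite B → Finite (A × B)
  finProd {A} {B} FA FB = record { size = size FA ℕ.* size FB ; to = t ; from = f ; from-to = ft }
    where
    t : A × B → Fin (size FA ℕ.* size FB)
    t (a , b) = F.combine (to FA a) (to FB b)
    g : Fin (size FA) × Fin (size FB) → A × B
    g (x , y) = from FA x , from FB y
    f : Fin (size FA ℕ.* size FB) → A × B
    f i = g (F.remQuot {size FA} (size FB) i)
    ft : ∀ p → f (t p) ≡ p
    ft (a , b) = trans (cong g (FP.remQuot-combine {size FA} {size FB} (to FA a) (to FB b)))
                       (cong₂ _,_ (from-to FA a) (from-to FB b))

  finSum : ∀ {A B : Set} → Finite A → Finite B → Finite (A ⊎ B)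
  finSum {A} {B} FA FB = record { size = size FA ℕ.+ size FB ; to = t ; from = λ i → h (F.splitAt (size FA) i) ; from-to = ft }
    where
    h : Fin (size FA) ⊎ Fin (size FB) → A ⊎ B
    h (inj₁ i) = inj₁ (from FA i)
    h (inj₂ i) = inj₂ (from FB i)
    t : A ⊎ B → Fin (size FA ℕ.+ size FB)
    t (inj₁ a) = to FA a F.↑ˡ size FB
    t (inj₂ b) = size FA F.↑ʳ to FB b
    ft : ∀ x → h (F.splitAt (size FA) (t x)) ≡ x
    ft (inj₁ a) = trans (cong h (FP.splitAt-↑ˡ (size FA) (to FA a) (size FB))) (cong inj₁ (from-to FA a))
    ft (inj₂ b) = trans (cong h (FP.splitAt-↑ʳ (size FA) (size FB) (to FB b))) (cong inj₂ (from-to FB b))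

  finRetract : ∀ {A B : Set} → Finite A → (f : A → B) (g : B → A) → (∀ b → f (g b) ≡ b) → Finite B
  finRetract FA f g fg = record { size = size FA ; to = λ b → to FA (g b) ; from = λ i → f (from FA i)
                                ; from-to = λ b → trans (cong f (from-to FA (g b))) (fg b) }

  finBool : Finite Bool
  finBool = record { size = 2 ; to = λ { false → # 0 ; true → # 1 }
                   ; from = λ { zero → false ; (suc _) → true } ; from-to = λ { false → refl ; true → refl } }

  ∃? : ∀ {A : Set} {P : A → Set} (FA : Finite A) → (∀ a → Dec (P a)) → Dec (∃ P)
  ∃? {A} {P} FA P? with FP.any? (λ i → P? (from FA i))
  ... | yes (i , p) = yes (from FA i , p)
  ... | no ¬p = no λ { (a , p) → ¬p (to FA a , subst P (sym (from-to FA a)) p) }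

open Finiteness

does-sound : ∀ {P : Set} (d : Dec P) → does d ≡ true → P
does-sound (yes p) _ = p
does-sound (no _) ()

module IntegerFacts where
  private module ℤG = GroupProperties (AbelianGroup.group ℤP.+-0-abelianGroup)

  b≡b+x⇒x≡0 : ∀ b x → b ≡ b ℤ.+ x → x ≡ +0
  b≡b+x⇒x≡0 b x eq = ℤG.∙-cancelˡ b x +0 (trans (sym eq) (sym (ℤP.+-identityʳ b)))

  <⇒+1≤ : ∀ {a b} → a ℤ.< b → a ℤ.+ + 1 ℤ.≤ b
  <⇒+1≤ {a} lt = subst (ℤ._≤ _) (ℤP.+-comm (+ 1) a) (ℤP.i<j⇒suc[i]≤j lt)

  +1≤⇒< : ∀ {a b} → a ℤ.+ + 1 ℤ.≤ b → a ℤ.< b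
  +1≤⇒< {a} le = ℤP.suc[i]≤j⇒i<j (subst (ℤ._≤ _) (ℤP.+-comm a (+ 1)) le)

  i<i+1 : ∀ i → i ℤ.< i ℤ.+ + 1
  i<i+1 i = +1≤⇒< ℤP.≤-refl

  <⇒≤-1 : ∀ {a b} → a ℤ.< b → a ℤ.≤ b ℤ.- + 1
  <⇒≤-1 {a} {b} lt = subst (ℤ._≤ _) (cancel a) (ℤP.+-monoˡ-≤ (ℤ.- + 1) (<⇒+1≤ lt))
    where cancel : ∀ x → x ℤ.+ + 1 ℤ.+ ℤ.- + 1 ≡ x
          cancel = solve-∀

  <+1⇒≤ : ∀ {a b} → a ℤ.< b ℤ.+ + 1 → a ℤ.≤ b
  <+1⇒≤ {a} {b} lt = subst (a ℤ.≤_) (cancel b) (<⇒≤-1 lt)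
    where cancel : ∀ x → x ℤ.+ + 1 ℤ.- + 1 ≡ x
          cancel = solve-∀

  ≤-1⇒< : ∀ {a b} → a ℤ.≤ b ℤ.- + 1 → a ℤ.< b
  ≤-1⇒< {a} {b} le = ℤP.≤-<-trans le (subst (b ℤ.- + 1 ℤ.<_) (cancel b) (i<i+1 (b ℤ.- + 1)))
    where cancel : ∀ x → x ℤ.- + 1 ℤ.+ + 1 ≡ x
          cancel = solve-∀

  cell : ℤ → Fin 4 → ℤ
  cell k j = + 4 ℤ.* k ℤ.+ + toℕ j

  toℕ≤3 : (j : Fin 4) → + toℕ j ℤ.≤ + 3
  toℕ≤3 j = ℤ.+≤+ (ℕP.≤-pred (FP.toℕ<n j))

  cell-< : ∀ k K a b → k ℤ.< K → cell k a ℤ.< cell K b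
  cell-< k K a b k<K = begin-strict
    + 4 ℤ.* k ℤ.+ + toℕ a  ≤⟨ ℤP.+-monoʳ-≤ (+ 4 ℤ.* k) (toℕ≤3 a) ⟩
    + 4 ℤ.* k ℤ.+ + 3      <⟨ ℤP.+-monoʳ-< (+ 4 ℤ.* k) (ℤ.+<+ (ℕP.n<1+n 3)) ⟩
    + 4 ℤ.* k ℤ.+ + 4      ≡⟨ four k ⟩
    + 4 ℤ.* (+ 1 ℤ.+ k)    ≤⟨ ℤP.*-monoˡ-≤-nonNeg (+ 4) (ℤP.i<j⇒suc[i]≤j k<K) ⟩
    + 4 ℤ.* K              ≤⟨ ℤP.i≤i+j (+ 4 ℤ.* K) (+ toℕ b) ⟩
    + 4 ℤ.* K ℤ.+ + toℕ b  ∎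
    where
    open ℤP.≤-Reasoning
    four : ∀ k → + 4 ℤ.* k ℤ.+ + 4 ≡ + 4 ℤ.* (+ 1 ℤ.+ k)
    four = solve-∀

  cell-injective : ∀ k K a b → cell k a ≡ cell K b → k ≡ K × a ≡ b
  cell-injective k K a b eq with ℤP.<-cmp k K
  ... | tri< lt _ _ = ⊥-elim (ℤP.<⇒≢ (cell-< k K a b lt) eq)
  ... | tri> _ _ gt = ⊥-elim (ℤP.<⇒≢ (cell-< K k b a gt) (sym eq))
  ... | tri≈ _ refl _ = refl , FP.toℕ-injective (ℤP.+-injective (ℤG.∙-cancelˡ (+ 4 ℤ.* k) _ _ eq))

  cell-≟ : ∀ k K jj j → does (cell k jj ℤP.≟ cell K j) ≡ does (jj FP.≟ j) ∧ does (k ℤP.≟ K)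
  cell-≟ k K jj j = does-⇔ (mk⇔ (λ e → let (e₁ , e₂) = cell-injective k K jj j e in e₂ , e₁)
                                (λ { (refl , refl) → refl }))
                           (cell k jj ℤP.≟ cell K j) ((jj FP.≟ j) ×-dec (k ℤP.≟ K))


  -- How the order bit [P₁ ≤ P₂] changes when one head moves one block;
  -- the simulator evaluates the left-hand sides.
  order-right₁ : ∀ P₁ P₂ → does (P₁ ℤP.≤? P₂) ∧ not (does (P₁ ℤP.≟ P₂)) ≡ does (P₁ ℤ.+ + 1 ℤP.≤? P₂)
  order-right₁ P₁ P₂ = does-⇔
    (mk⇔ (λ (le , ne) → <⇒+1≤ (ℤP.≤∧≢⇒< le ne)) (λ le → ℤP.<⇒≤ (+1≤⇒< le) , ℤP.<⇒≢ (+1≤⇒< le)))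
    ((P₁ ℤP.≤? P₂) ×-dec ¬? (P₁ ℤP.≟ P₂)) (P₁ ℤ.+ + 1 ℤP.≤? P₂)

  order-left₁ : ∀ P₁ P₂ → does (P₁ ℤP.≤? P₂) ∨ does (P₁ ℤ.- + 1 ℤP.≟ P₂) ≡ does (P₁ ℤ.- + 1 ℤP.≤? P₂)
  order-left₁ P₁ P₂ = does-⇔ (mk⇔ to from) ((P₁ ℤP.≤? P₂) ⊎-dec (P₁ ℤ.- + 1 ℤP.≟ P₂)) (P₁ ℤ.- + 1 ℤP.≤? P₂)
    where
    cancel : ∀ x → x ℤ.- + 1 ℤ.+ + 1 ≡ x
    cancel = solve-∀
    to : P₁ ℤ.≤ P₂ ⊎ P₁ ℤ.- + 1 ≡ P₂ → P₁ ℤ.- + 1 ℤ.≤ P₂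
    to (inj₁ le) = ℤP.i≤j⇒i-k≤j (+ 1) le
    to (inj₂ e)  = ℤP.≤-reflexive e
    from : P₁ ℤ.- + 1 ℤ.≤ P₂ → P₁ ℤ.≤ P₂ ⊎ P₁ ℤ.- + 1 ≡ P₂
    from le with P₁ ℤ.- + 1 ℤP.≟ P₂
    ... | yes e = inj₂ e
    ... | no ne = inj₁ (subst (ℤ._≤ P₂) (cancel P₁) (<⇒+1≤ (ℤP.≤∧≢⇒< le ne)))

  order-right₂ : ∀ P₁ P₂ → does (P₁ ℤP.≤? P₂) ∨ does (P₂ ℤ.+ + 1 ℤP.≟ P₁) ≡ does (P₁ ℤP.≤? P₂ ℤ.+ + 1)
  order-right₂ P₁ P₂ = does-⇔ (mk⇔ to from) ((P₁ ℤP.≤? P₂) ⊎-dec (P₂ ℤ.+ + 1 ℤP.≟ P₁)) (P₁ ℤP.≤? P₂ ℤ.+ + 1)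
    where
    to : P₁ ℤ.≤ P₂ ⊎ P₂ ℤ.+ + 1 ≡ P₁ → P₁ ℤ.≤ P₂ ℤ.+ + 1
    to (inj₁ le) = ℤP.≤-trans le (ℤP.<⇒≤ (i<i+1 P₂))
    to (inj₂ e)  = ℤP.≤-reflexive (sym e)
    from : P₁ ℤ.≤ P₂ ℤ.+ + 1 → P₁ ℤ.≤ P₂ ⊎ P₂ ℤ.+ + 1 ≡ P₁
    from le with P₂ ℤ.+ + 1 ℤP.≟ P₁
    ... | yes e = inj₂ e
    ... | no ne = inj₁ (<+1⇒≤ (ℤP.≤∧≢⇒< le (λ e → ne (sym e))))

  order-left₂ : ∀ P₁ P₂ → does (P₁ ℤP.≤? P₂) ∧ not (does (P₂ ℤP.≟ P₁)) ≡ does (P₁ ℤP.≤? P₂ ℤ.- + 1)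
  order-left₂ P₁ P₂ = does-⇔
    (mk⇔ (λ (le , ne) → <⇒≤-1 (ℤP.≤∧≢⇒< le (λ e → ne (sym e))))
         (λ le → ℤP.<⇒≤ (≤-1⇒< le) , λ e → ℤP.<⇒≢ (≤-1⇒< le) (sym e)))
    ((P₁ ℤP.≤? P₂) ×-dec ¬? (P₂ ℤP.≟ P₁)) (P₁ ℤP.≤? P₂ ℤ.- + 1)

  update : ∀ {X : Set} → (ℤ → X) → ℤ → X → ℤ → X
  update f p v x = if does (x ℤP.≟ p) then v else f x

  -- zero test and predecessor, defined by cases so that they compute on constructors
  isZero : ℤ → Bool
  isZero (+ zero) = true
  isZero _        = false

  isZero-diff : ∀ x N → isZero (x ℤ.- N) ≡ does (x ℤP.≟ N)
  isZero-diff x N with x ℤP.≟ N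
  ... | yes refl rewrite ℤP.+-inverseʳ x = refl
  ... | no x≢N with x ℤ.- N in eq
  ...   | + zero   = ⊥-elim (x≢N (ℤP.i-j≡0⇒i≡j x N eq))
  ...   | + suc n  = refl
  ...   | -[1+ n ] = refl

  pred : ℤ → ℤ
  pred (+ zero)  = -[1+ 0 ]
  pred (+ suc n) = + n
  pred -[1+ n ]  = -[1+ suc n ]

  pred≡i-1 : ∀ i → pred i ≡ i ℤ.- + 1
  pred≡i-1 (+ zero)  = refl
  pred≡i-1 (+ suc n) = refl
  pred≡i-1 -[1+ n ]  = cong (λ m → -[1+ suc m ]) (sym (ℕP.+-identityʳ n))

open IntegerFacts

module Tapes (nA nD nCh : ℕ) where
  open Params nA nD nCh

  shift : Dir → ℤ → ℤ
  shift L N = N ℤ.- + 1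
  shift R N = N ℤ.+ + 1

  nth : Side → ℕ → DBox
  nth s zero    = proj₁ (pop s)
  nth s (suc n) = nth (proj₂ (pop s)) n

  val : Tape → ℤ → DBox
  val (l , d , r) (+ zero)  = d
  val (l , d , r) (+ suc n) = nth r n
  val (l , d , r) -[1+ n ]  = nth l n

  hd : Tape → DBox
  hd (l , d , r) = d

  pop-push : ∀ e s → pop (push e s) ≡ (e , s)
  pop-push nothing  nothing         = refl
  pop-push (just x) nothing         = refl
  pop-push nothing  (just (xs , d)) = refl
  pop-push (just x) (just (xs , d)) = refl

  mvT : Dir → DBox → Tape → Tape
  mvT L e (l , d , r) = (proj₂ (pop l) , proj₁ (pop l) , push e r)
  mvT R e (l , d , r) = (push e l , proj₁ (pop r) , proj₂ (pop r))

  val-mvR-pred : ∀ e T D → val (mvT R e T) (pred D) ≡ (if isZero D then e else val T D)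
  val-mvR-pred e (l , d , r) (+ zero)        = cong proj₁ (pop-push e l)
  val-mvR-pred e (l , d , r) (+ suc zero)    = refl
  val-mvR-pred e (l , d , r) (+ suc (suc n)) = refl
  val-mvR-pred e (l , d , r) -[1+ n ]        = cong (λ s → nth s n) (cong proj₂ (pop-push e l))

  val-mvT : ∀ X e T z → val (mvT X e T) z ≡ (if isZero (shift X z) then e else val T (shift X z))
  val-mvT R e T z = trans (cong (val (mvT R e T)) z≡pred) (val-mvR-pred e T (z ℤ.+ + 1))
    where
    cancel : ∀ z → z ≡ z ℤ.+ + 1 ℤ.- + 1
    cancel = solve-∀
    z≡pred : z ≡ pred (z ℤ.+ + 1)
    z≡pred = trans (cancel z) (sym (pred≡i-1 (z ℤ.+ + 1)))
  val-mvT L e (l , d , r) (+ zero)        = refl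
  val-mvT L e (l , d , r) (+ suc zero)    = cong proj₁ (pop-push e r)
  val-mvT L e (l , d , r) (+ suc (suc n)) = cong (λ s → nth s n) (cong proj₂ (pop-push e r))
  val-mvT L e (l , d , r) -[1+ zero ]     = refl
  val-mvT L e (l , d , r) -[1+ suc n ]    = cong (λ m → nth (proj₂ (pop l)) (suc m)) (sym (ℕP.+-identityʳ n))

  shift-back : ∀ X x N → shift X (x ℤ.- shift X N) ≡ x ℤ.- N
  shift-back R x N = cancel x N where cancel : ∀ x N → x ℤ.- (N ℤ.+ + 1) ℤ.+ + 1 ≡ x ℤ.- N
                                      cancel = solve-∀
  shift-back L x N = cancel x N where cancel : ∀ x N → x ℤ.- (N ℤ.- + 1) ℤ.- + 1 ≡ x ℤ.- N
                                      cancel = solve-∀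

  val-after-step : ∀ X e T N x →
    val (mvT X e T) (x ℤ.- shift X N) ≡ (if does (x ℤP.≟ N) then e else val T (x ℤ.- N))
  val-after-step X e T N x rewrite val-mvT X e T (x ℤ.- shift X N) | shift-back X x N | isZero-diff x N = refl

  Rep : Tape → (ℤ → DBox) → ℤ → Set
  Rep T A P = ∀ x → val T (x ℤ.- P) ≡ A x

  rep-mvT : ∀ X e T A P → Rep T A P → Rep (mvT X e T) (update A P e) (shift X P)
  rep-mvT X e T A P rp x rewrite val-after-step X e T P x = cong (if does (x ℤP.≟ P) then e else_) (rp x)

  hd-rep : ∀ {T A P} → Rep T A P → hd T ≡ A P
  hd-rep {l , d , r} {A} {P} rp = trans (cong (val (l , d , r)) (sym (ℤP.+-inverseʳ P))) (rp P)

  val-empty : ∀ z → val emptyTape z ≡ nothing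
  val-empty (+ zero)  = refl
  val-empty (+ suc n) = nth-nothing n
    where nth-nothing : ∀ n → nth nothing n ≡ nothing
          nth-nothing zero    = refl
          nth-nothing (suc n) = nth-nothing n
  val-empty -[1+ n ]  = val-empty (+ suc n)

  rtm-step : ∀ (M : RTM) {s T a e X t} → RTM.trans M s (hd T) a e X t ≡ true →
             RTMStep M (s , T) a (t , mvT X e T)
  rtm-step M {T = l , d , r} {X = L} tr = stepL tr
  rtm-step M {T = l , d , r} {X = R} tr = stepR tr

  rtm-step⁻¹ : ∀ (M : RTM) {s T a s' T'} → RTMStep M (s , T) a (s' , T') →
    Σ DBox λ e → Σ Dir λ X → RTM.trans M s (hd T) a e X s' ≡ true × T' ≡ mvT X e T
  rtm-step⁻¹ M (stepL tr) = _ , L , tr , refl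
  rtm-step⁻¹ M (stepR tr) = _ , R , tr , refl

  τ? : (a : Actτ) → Dec (a ≡ τ)
  τ? τ     = yes refl
  τ? ⌜ _ ⌝ = no λ ()

  restricted? : ∀ C a → Dec (Restricted C a)
  restricted? C τ           = no λ ()
  restricted? C ⌜ act _ ⌝   = no λ ()
  restricted? C ⌜ c ! _ ⌝   = c ∈? C
  restricted? C ⌜ c ⁇ _ ⌝   = c ∈? C

  finDBox : Finite DBox
  finDBox = finMaybe (finFin nD)

  finDir : Finite Dir
  finDir = finRetract finBool (λ { false → L ; true → R }) (λ { L → false ; R → true }) (λ { L → refl ; R → refl })

  shiftN : Dir → ℕ → ℤ → ℤ
  shiftN D zero    b = b
  shiftN D (suc n) b = shiftN D n (shift D b)

  shiftN-R : ∀ n b → shiftN R n b ≡ b ℤ.+ + n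
  shiftN-R zero    b = sym (ℤP.+-identityʳ b)
  shiftN-R (suc n) b = trans (shiftN-R n (b ℤ.+ + 1)) (assoc b (+ n))
    where assoc : ∀ b x → b ℤ.+ + 1 ℤ.+ x ≡ b ℤ.+ (+ 1 ℤ.+ x)
          assoc = solve-∀

  shiftN-L : ∀ n b → shiftN L n b ≡ b ℤ.- + n
  shiftN-L zero    b = sym (ℤP.+-identityʳ b)
  shiftN-L (suc n) b = trans (shiftN-L n (b ℤ.- + 1)) (assoc b (+ n))
    where assoc : ∀ b x → b ℤ.- + 1 ℤ.- x ≡ b ℤ.- (+ 1 ℤ.+ x)
          assoc = solve-∀

  shiftN-≢ : ∀ D n b → b ≢ shiftN D (suc n) b
  shiftN-≢ R n b eq with b≡b+x⇒x≡0 b (+ suc n) (trans eq (shiftN-R (suc n) b))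
  ... | ()
  shiftN-≢ L n b eq with b≡b+x⇒x≡0 b (ℤ.- + suc n) (trans eq (shiftN-L (suc n) b))
  ... | ()

  distance : ∀ a b → a ℤ.≤ b → Σ ℕ λ n → b ≡ shiftN R n a × a ≡ shiftN L n b
  distance a b le = ℤ.∣ b ℤ.- a ∣ , rightward , leftward
    where
    abs≡ : + ℤ.∣ b ℤ.- a ∣ ≡ b ℤ.- a
    abs≡ = ℤP.0≤i⇒+∣i∣≡i (ℤP.i≤j⇒0≤j-i le)
    rightward : b ≡ shiftN R ℤ.∣ b ℤ.- a ∣ a
    rightward rewrite shiftN-R ℤ.∣ b ℤ.- a ∣ a | abs≡ = lemma a b
      where lemma : ∀ a b → b ≡ a ℤ.+ (b ℤ.- a)
            lemma = solve-∀
    leftward : a ≡ shiftN L ℤ.∣ b ℤ.- a ∣ b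
    leftward rewrite shiftN-L ℤ.∣ b ℤ.- a ∣ b | abs≡ = lemma a b
      where lemma : ∀ a b → a ≡ b ℤ.- (b ℤ.- a)
            lemma = solve-∀

module StrongBisimulation (nA nD nCh : ℕ) where
  open Params nA nD nCh

  record StrongHalf (T₁ T₂ : TS) (ℛ : TS.State T₁ → TS.State T₂ → Set) : Set where
    field
      step  : ∀ {s₁ s₂ a s₁'} → ℛ s₁ s₂ → TS._⟶[_]_ T₁ s₁ a s₁' →
              ∃ λ s₂' → TS._⟶[_]_ T₂ s₂ a s₂' × ℛ s₁' s₂'
      final : ∀ {s₁ s₂} → ℛ s₁ s₂ → TS.Final T₁ s₁ → TS.Final T₂ s₂

  strong⇒half : ∀ {T₁ T₂ ℛ} → StrongHalf T₁ T₂ ℛ → HalfBisim T₁ T₂ ℛ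
  strong⇒half {T₁} {T₂} {ℛ} sh = record { step = answer ; final = λ {s₁} {s₂} → finish {s₁} {s₂} ; diverge = diverge }
    where
    open StrongHalf sh
    answer : ∀ {s₁ s₂ a s₁'} → ℛ s₁ s₂ → TS._⟶[_]_ T₁ s₁ a s₁' →
             ∃ λ s₂'' → ∃ λ s₂' → _↠₂_ T₁ T₂ s₂ s₂'' × _⟶₂⟨_⟩_ T₁ T₂ s₂'' a s₂' ×
                                   ℛ s₁ s₂'' × ℛ s₁' s₂'
    answer {s₂ = s₂} r st = let (s₂' , st₂ , r') = step r st in s₂ , s₂' , ε , inj₁ st₂ , r , r'
    finish : ∀ {s₁ s₂} → ℛ s₁ s₂ → TS.Final T₁ s₁ →
             ∃ λ s₂' → _↠₂_ T₁ T₂ s₂ s₂' × TS.Final T₂ s₂' × ℛ s₁ s₂'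
    finish {s₁} {s₂} r f = s₂ , ε , final {s₁} {s₂} r f , r
    diverge : ∀ {s₁ s₂} → ℛ s₁ s₂ → (f : ℕ → TS.State T₁) → f zero ≡ s₁ →
              (∀ i → TS._⟶[_]_ T₁ (f i) τ (f (suc i))) →
              (∀ i → ℛ (f i) s₂) → ∃ λ s₂' → _↠⁺₂_ T₁ T₂ s₂ s₂' × ∃ λ i → ℛ (f i) s₂'
    diverge r f refl steps _ = let (s₂' , st₂ , r') = step r (steps 0) in s₂' , [ st₂ ] , 1 , r'

-- The steps of 𝒯([M₁ ∥ M₂]_C), described by finite data: which machine
-- moves (or both, synchronising), to which control state, writing what,
-- moving where.  Both simulating machines decide their visible steps by
-- searching this finite space.
module JointMoves (nA nD nCh : ℕ) (M₁ M₂ : Params.RTM nA nD nCh) (C : Subset nCh) where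
  open Params nA nD nCh
  open Tapes nA nD nCh
  module M₁ = RTM M₁
  module M₂ = RTM M₂

  Move₁ : Set
  Move₁ = Fin M₁.nStates × DBox × Dir

  Move₂ : Set
  Move₂ = Fin M₂.nStates × DBox × Dir

  Choice : Set
  Choice = Move₁ ⊎ (Move₂ ⊎ (Move₁ × Move₂))

  finChoice : Finite Choice
  finChoice = finSum finMove₁ (finSum finMove₂ (finProd finMove₁ finMove₂))
    where
    finMove₁ : Finite Move₁
    finMove₁ = finProd (finFin M₁.nStates) (finProd finDBox finDir)
    finMove₂ : Finite Move₂
    finMove₂ = finProd (finFin M₂.nStates) (finProd finDBox finDir)

  Syncs : Fin M₁.nStates → DBox → Fin M₂.nStates → DBox → Move₁ → Move₂ → Chan × DBox → Set
  Syncs q₁ h₁ q₂ h₂ (t₁ , e₁ , X₁) (t₂ , e₂ , X₂) (c , d) = c ∈ C ×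
    ((M₁.trans q₁ h₁ ⌜ c ! d ⌝ e₁ X₁ t₁ ≡ true × M₂.trans q₂ h₂ ⌜ c ⁇ d ⌝ e₂ X₂ t₂ ≡ true) ⊎
     (M₁.trans q₁ h₁ ⌜ c ⁇ d ⌝ e₁ X₁ t₁ ≡ true × M₂.trans q₂ h₂ ⌜ c ! d ⌝ e₂ X₂ t₂ ≡ true))

  Valid : Fin M₁.nStates → DBox → Fin M₂.nStates → DBox → Choice → Actτ → Set
  Valid q₁ h₁ q₂ h₂ (inj₁ (t₁ , e₁ , X₁)) a = M₁.trans q₁ h₁ a e₁ X₁ t₁ ≡ true × ¬ Restricted C a
  Valid q₁ h₁ q₂ h₂ (inj₂ (inj₁ (t₂ , e₂ , X₂))) a = M₂.trans q₂ h₂ a e₂ X₂ t₂ ≡ true × ¬ Restricted C a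
  Valid q₁ h₁ q₂ h₂ (inj₂ (inj₂ (m₁ , m₂))) a = a ≡ τ × ∃ (Syncs q₁ h₁ q₂ h₂ m₁ m₂)

  syncs? : ∀ q₁ h₁ q₂ h₂ m₁ m₂ cd → Dec (Syncs q₁ h₁ q₂ h₂ m₁ m₂ cd)
  syncs? q₁ h₁ q₂ h₂ (t₁ , e₁ , X₁) (t₂ , e₂ , X₂) (c , d) = (c ∈? C) ×-dec
    (((M₁.trans q₁ h₁ ⌜ c ! d ⌝ e₁ X₁ t₁ BP.≟ true) ×-dec
      (M₂.trans q₂ h₂ ⌜ c ⁇ d ⌝ e₂ X₂ t₂ BP.≟ true)) ⊎-dec
     ((M₁.trans q₁ h₁ ⌜ c ⁇ d ⌝ e₁ X₁ t₁ BP.≟ true) ×-dec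
      (M₂.trans q₂ h₂ ⌜ c ! d ⌝ e₂ X₂ t₂ BP.≟ true)))

  valid? : ∀ q₁ h₁ q₂ h₂ ch a → Dec (Valid q₁ h₁ q₂ h₂ ch a)
  valid? q₁ h₁ q₂ h₂ (inj₁ (t₁ , e₁ , X₁)) a =
    (M₁.trans q₁ h₁ a e₁ X₁ t₁ BP.≟ true) ×-dec ¬? (restricted? C a)
  valid? q₁ h₁ q₂ h₂ (inj₂ (inj₁ (t₂ , e₂ , X₂))) a =
    (M₂.trans q₂ h₂ a e₂ X₂ t₂ BP.≟ true) ×-dec ¬? (restricted? C a)
  valid? q₁ h₁ q₂ h₂ (inj₂ (inj₂ (m₁ , m₂))) a =
    τ? a ×-dec ∃? (finProd (finFin nCh) finDBox) (syncs? q₁ h₁ q₂ h₂ m₁ m₂)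

  ParSt : Set
  ParSt = TS.State (𝒯Par C M₁ M₂)

  PStep : ParSt → Actτ → ParSt → Set
  PStep = ParStep C (𝒯 M₁) (𝒯 M₂)

  states : Choice → Fin M₁.nStates → Fin M₂.nStates → Fin M₁.nStates × Fin M₂.nStates
  states (inj₁ (t₁ , _)) q₁ q₂ = t₁ , q₂
  states (inj₂ (inj₁ (t₂ , _))) q₁ q₂ = q₁ , t₂
  states (inj₂ (inj₂ ((t₁ , _) , (t₂ , _)))) q₁ q₂ = t₁ , t₂

  perform : Choice → ParSt → ParSt
  perform (inj₁ (t₁ , e₁ , X₁)) ((q₁ , T₁) , p₂) = (t₁ , mvT X₁ e₁ T₁) , p₂
  perform (inj₂ (inj₁ (t₂ , e₂ , X₂))) (p₁ , (q₂ , T₂)) = p₁ , (t₂ , mvT X₂ e₂ T₂)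
  perform (inj₂ (inj₂ ((t₁ , e₁ , X₁) , (t₂ , e₂ , X₂)))) ((q₁ , T₁) , (q₂ , T₂)) =
    (t₁ , mvT X₁ e₁ T₁) , (t₂ , mvT X₂ e₂ T₂)

  valid⇒step : ∀ {q₁ T₁ q₂ T₂} ch a → Valid q₁ (hd T₁) q₂ (hd T₂) ch a →
               PStep ((q₁ , T₁) , (q₂ , T₂)) a (perform ch ((q₁ , T₁) , (q₂ , T₂)))
  valid⇒step (inj₁ _) a (tr , nr) = left nr (rtm-step M₁ tr)
  valid⇒step (inj₂ (inj₁ _)) a (tr , nr) = right nr (rtm-step M₂ tr)
  valid⇒step (inj₂ (inj₂ _)) .τ (refl , _ , c∈C , inj₁ (tr₁ , tr₂)) = comm!? c∈C (rtm-step M₁ tr₁) (rtm-step M₂ tr₂)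
  valid⇒step (inj₂ (inj₂ _)) .τ (refl , _ , c∈C , inj₂ (tr₁ , tr₂)) = comm?! c∈C (rtm-step M₁ tr₁) (rtm-step M₂ tr₂)

  step⇒valid : ∀ {q₁ T₁ q₂ T₂ a p'} → PStep ((q₁ , T₁) , (q₂ , T₂)) a p' →
    Σ Choice λ ch → Valid q₁ (hd T₁) q₂ (hd T₂) ch a × p' ≡ perform ch ((q₁ , T₁) , (q₂ , T₂))
  step⇒valid (left nr st) with rtm-step⁻¹ M₁ st
  ... | e , X , tr , refl = inj₁ (_ , e , X) , (tr , nr) , refl
  step⇒valid (right nr st) with rtm-step⁻¹ M₂ st
  ... | e , X , tr , refl = inj₂ (inj₁ (_ , e , X)) , (tr , nr) , refl
  step⇒valid (comm!? c∈C st₁ st₂) with rtm-step⁻¹ M₁ st₁ | rtm-step⁻¹ M₂ st₂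
  ... | e₁ , X₁ , tr₁ , refl | e₂ , X₂ , tr₂ , refl =
    inj₂ (inj₂ ((_ , e₁ , X₁) , (_ , e₂ , X₂))) , (refl , _ , c∈C , inj₁ (tr₁ , tr₂)) , refl
  step⇒valid (comm?! c∈C st₁ st₂) with rtm-step⁻¹ M₁ st₁ | rtm-step⁻¹ M₂ st₂
  ... | e₁ , X₁ , tr₁ , refl | e₂ , X₂ , tr₂ , refl =
    inj₂ (inj₂ ((_ , e₁ , X₁) , (_ , e₂ , X₂))) , (refl , _ , c∈C , inj₂ (tr₁ , tr₂)) , refl

  controls : ParSt → Fin M₁.nStates × Fin M₂.nStates
  controls ((q₁ , _) , (q₂ , _)) = q₁ , q₂

  controls-perform : ∀ ch p → controls (perform ch p) ≡ states ch (proj₁ (controls p)) (proj₂ (controls p))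
  controls-perform (inj₁ _) _ = refl
  controls-perform (inj₂ (inj₁ _)) _ = refl
  controls-perform (inj₂ (inj₂ _)) _ = refl

-- Case 𝒟 = ∅: all tapes stay blank, so the product of the two finite
-- controls, taking every visible step of the composition, suffices.
module BlankTapes (nA nCh : ℕ) (M₁ M₂ : Params.RTM nA 0 nCh) (C : Subset nCh) where
  open Params nA 0 nCh
  open Tapes nA 0 nCh
  open JointMoves nA 0 nCh M₁ M₂ C
  open StrongBisimulation nA 0 nCh

  only-□ : (d : DBox) → d ≡ □
  only-□ nothing  = refl
  only-□ (just ())

  valid-□ : ∀ {q₁ q₂ ch a} T₁ T₂ → Valid q₁ □ q₂ □ ch a → Valid q₁ (hd T₁) q₂ (hd T₂) ch a
  valid-□ T₁ T₂ v rewrite only-□ (hd T₁) | only-□ (hd T₂) = v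

  -- the product machine's states encode pairs of control states; the
  -- encoding is abstract so that typechecking never unfolds it
  Controls : Set
  Controls = Fin M₁.nStates × Fin M₂.nStates

  abstract
    NZ : ℕ
    NZ = Finite.size (finProd (finFin M₁.nStates) (finFin M₂.nStates))
    toZ : Controls → Fin NZ
    toZ = Finite.to (finProd (finFin M₁.nStates) (finFin M₂.nStates))
    fromZ : Fin NZ → Controls
    fromZ = Finite.from (finProd (finFin M₁.nStates) (finFin M₂.nStates))
    fromZ-to : ∀ x → fromZ (toZ x) ≡ x
    fromZ-to = Finite.from-to (finProd (finFin M₁.nStates) (finFin M₂.nStates))

  ProductStep : Controls → Actτ → Fin NZ → Set
  ProductStep (q₁ , q₂) a t = Σ Choice λ ch → Valid q₁ □ q₂ □ ch a × t ≡ toZ (states ch q₁ q₂)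

  productStep? : ∀ q a t → Dec (ProductStep q a t)
  productStep? (q₁ , q₂) a t = ∃? finChoice λ ch → valid? q₁ □ q₂ □ ch a ×-dec (t FP.≟ toZ (states ch q₁ q₂))

  Product : RTM
  Product = record
    { nStates = NZ
    ; init    = toZ (M₁.init , M₂.init)
    ; final   = λ s → M₁.final (proj₁ (fromZ s)) ∧ M₂.final (proj₂ (fromZ s))
    ; trans   = λ s d a e X t → does (productStep? (fromZ s) a t) }

  Corr : Config Product → ParSt → Set
  Corr (s , _) p = fromZ s ≡ controls p

  product⇒par : ∀ {s T p a s' T'} → Corr (s , T) p → RTMStep Product (s , T) a (s' , T') →
                Σ ParSt λ p' → PStep p a p' × Corr (s' , T') p'
  product⇒par {s} {p = (q₁ , T₁) , (q₂ , T₂)} {a} {s'} eq st with rtm-step⁻¹ Product st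
  ... | _ , _ , tr , refl with subst (λ q → ProductStep q a s') eq (does-sound (productStep? (fromZ s) a s') tr)
  ... | ch , v , refl = _ , valid⇒step ch a (valid-□ T₁ T₂ v) , trans (fromZ-to _) (sym (controls-perform ch _))

  par⇒product : ∀ {s T p a p'} → Corr (s , T) p → PStep p a p' →
                Σ (Config Product) λ m' → RTMStep Product (s , T) a m' × Corr m' p'
  par⇒product {s} {T} {p = (q₁ , T₁) , (q₂ , T₂)} {a} eq pst with step⇒valid pst
  ... | ch , v , refl = _ , rtm-step Product {e = hd T} {X = R} (dec-true (productStep? (fromZ s) a _) chosen) ,
                        trans (fromZ-to _) (sym (controls-perform ch _))
    where
    chosen : ProductStep (fromZ s) a (toZ (states ch q₁ q₂))
    chosen rewrite eq | only-□ (hd T₁) | only-□ (hd T₂) = ch , v , refl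

  final⇒final : ∀ {m p} → Corr m p → TS.Final (𝒯 Product) m → TS.Final (𝒯Par C M₁ M₂) p
  final⇒final {s , _} {(q₁ , _) , (q₂ , _)} c fin rewrite c = BP.∧-conicalˡ _ _ fin , BP.∧-conicalʳ _ _ fin

  final⇐final : ∀ {m p} → Corr m p → TS.Final (𝒯Par C M₁ M₂) p → TS.Final (𝒯 Product) m
  final⇐final {s , _} {(q₁ , _) , (q₂ , _)} c (f₁ , f₂) rewrite c | f₁ | f₂ = refl

  simulates : 𝒯 Product ↔bΔ 𝒯Par C M₁ M₂
  simulates = Corr ,
    record { forth = strong⇒half record { step = product⇒par ; final = λ {m} {p} → final⇒final {m} {p} }
           ; back  = strong⇒half record { step = par⇒product ; final = λ {p} {m} → final⇐final {m} {p} } } ,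
    fromZ-to _

-- Block layouts: a world assigns a symbol to every cell j of every block k,
-- i.e. to every position cell k j of the simulator's tape.
module Layouts (nA nD nCh : ℕ) (marker : Fin nD) where
  open Params nA nD nCh
  open Tapes nA nD nCh

  World : Set
  World = ℤ → Fin 4 → DBox

  Shows : Tape → ℤ → World → Set
  Shows T N W = ∀ k j → val T (cell k j ℤ.- N) ≡ W k j

  write : World → ℤ → DBox → World
  write W N e k j = if does (cell k j ℤP.≟ N) then e else W k j

  shows-step : ∀ X e T N W → Shows T N W → Shows (mvT X e T) (shift X N) (write W N e)
  shows-step X e T N W ok k j rewrite val-after-step X e T N (cell k j) with cell k j ℤP.≟ N
  ... | yes _ = refl
  ... | no _  = ok k j

  shows-≗ : ∀ {T N W W'} → Shows T N W → (∀ k j → W k j ≡ W' k j) → Shows T N W'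
  shows-≗ ok eq k j = trans (ok k j) (eq k j)

  shows-hd : ∀ {T N W} k j → Shows T N W → cell k j ≡ N → hd T ≡ W k j
  shows-hd {l , d , r} k j ok refl = trans (cong (val (l , d , r)) (sym (ℤP.+-inverseʳ (cell k j)))) (ok k j)

  write-hd : ∀ {T N W} → Shows T N W → ∀ k j → write W N (hd T) k j ≡ W k j
  write-hd {T} {N} {W} ok k j with cell k j ℤP.≟ N
  ... | yes p = shows-hd k j ok p
  ... | no _  = refl

  write-cell : ∀ W K j e k jj → write W (cell K j) e k jj ≡ (if does (jj FP.≟ j) ∧ does (k ℤP.≟ K) then e else W k jj)
  write-cell W K j e k jj = cong (λ b → if b then e else W k jj) (cell-≟ k K jj j)

  Pos : Set
  Pos = ℤ × Fin 4

  cellP : Pos → ℤ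
  cellP (K , j) = cell K j

  nextPos : Dir → Pos → Pos
  nextPos R (K , zero)                   = K , # 1
  nextPos R (K , suc zero)               = K , # 2
  nextPos R (K , suc (suc zero))         = K , # 3
  nextPos R (K , suc (suc (suc zero)))   = K ℤ.+ + 1 , # 0
  nextPos L (K , zero)                   = K ℤ.- + 1 , # 3
  nextPos L (K , suc zero)               = K , # 0
  nextPos L (K , suc (suc zero))         = K , # 1
  nextPos L (K , suc (suc (suc zero)))   = K , # 2

  shift-cellP : ∀ X p → shift X (cellP p) ≡ cellP (nextPos X p)
  shift-cellP R (K , zero)                 = lemma K where lemma : ∀ K → + 4 ℤ.* K ℤ.+ + 0 ℤ.+ + 1 ≡ + 4 ℤ.* K ℤ.+ + 1
                                                           lemma = solve-∀
  shift-cellP R (K , suc zero)             = lemma K where lemma : ∀ K → + 4 ℤ.* K ℤ.+ + 1 ℤ.+ + 1 ≡ + 4 ℤ.* K ℤ.+ + 2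
                                                           lemma = solve-∀
  shift-cellP R (K , suc (suc zero))       = lemma K where lemma : ∀ K → + 4 ℤ.* K ℤ.+ + 2 ℤ.+ + 1 ≡ + 4 ℤ.* K ℤ.+ + 3
                                                           lemma = solve-∀
  shift-cellP R (K , suc (suc (suc zero))) = lemma K where lemma : ∀ K → + 4 ℤ.* K ℤ.+ + 3 ℤ.+ + 1 ≡ + 4 ℤ.* (K ℤ.+ + 1) ℤ.+ + 0
                                                           lemma = solve-∀
  shift-cellP L (K , zero)                 = lemma K where lemma : ∀ K → + 4 ℤ.* K ℤ.+ + 0 ℤ.- + 1 ≡ + 4 ℤ.* (K ℤ.- + 1) ℤ.+ + 3
                                                           lemma = solve-∀
  shift-cellP L (K , suc zero)             = lemma K where lemma : ∀ K → + 4 ℤ.* K ℤ.+ + 1 ℤ.- + 1 ≡ + 4 ℤ.* K ℤ.+ + 0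
                                                           lemma = solve-∀
  shift-cellP L (K , suc (suc zero))       = lemma K where lemma : ∀ K → + 4 ℤ.* K ℤ.+ + 2 ℤ.- + 1 ≡ + 4 ℤ.* K ℤ.+ + 1
                                                           lemma = solve-∀
  shift-cellP L (K , suc (suc (suc zero))) = lemma K where lemma : ∀ K → + 4 ℤ.* K ℤ.+ + 3 ℤ.- + 1 ≡ + 4 ℤ.* K ℤ.+ + 2
                                                           lemma = solve-∀

  record LayAt (T : Tape) (p : Pos) (W : World) : Set where
    constructor lay
    field unlay : Shows T (cellP p) W
  open LayAt public

  layAt-step : ∀ X e T p W → LayAt T p W → LayAt (mvT X e T) (nextPos X p) (write W (cellP p) e)
  layAt-step X e T p W (lay ok) =
    lay (subst (λ N → Shows (mvT X e T) N (write W (cellP p) e)) (shift-cellP X p) (shows-step X e T (cellP p) W ok))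

  layAt-hd : ∀ {T W} p → LayAt T p W → hd T ≡ W (proj₁ p) (proj₂ p)
  layAt-hd (K , j) (lay ok) = shows-hd K j ok refl

  layAt-move : ∀ X {T p W} → LayAt T p W → LayAt (mvT X (hd T) T) (nextPos X p) W
  layAt-move X {T} {p} {W} (lay ok) = lay (shows-≗ (unlay (layAt-step X (hd T) T p W (lay ok))) (write-hd ok))

  𝟙 : DBox
  𝟙 = just marker

  mark : Bool → DBox
  mark true  = 𝟙
  mark false = nothing

  isMarked : DBox → Bool
  isMarked nothing  = false
  isMarked (just _) = true

  if-mark : ∀ b → (if b then 𝟙 else nothing) ≡ mark b
  if-mark true  = refl
  if-mark false = refl

  isMarked-mark : ∀ b → isMarked (mark b) ≡ b
  isMarked-mark true  = refl
  isMarked-mark false = refl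

  layout : (ℤ → DBox) → (ℤ → DBox) → ℤ → ℤ → World
  layout A₁ A₂ P₁ P₂ k zero                   = A₁ k
  layout A₁ A₂ P₁ P₂ k (suc zero)             = A₂ k
  layout A₁ A₂ P₁ P₂ k (suc (suc zero))       = mark (does (k ℤP.≟ P₁))
  layout A₁ A₂ P₁ P₂ k (suc (suc (suc zero))) = mark (does (k ℤP.≟ P₂))

  move-mark : ∀ k P P' → (if does (k ℤP.≟ P') then 𝟙 else (if does (k ℤP.≟ P) then nothing else mark (does (k ℤP.≟ P))))
                         ≡ mark (does (k ℤP.≟ P'))
  move-mark k P P' with k ℤP.≟ P' | k ℤP.≟ P
  ... | yes _ | _     = refl
  ... | no _  | yes _ = refl
  ... | no _  | no _  = refl

  relayout₁ : ∀ A₁ A₂ P P' P₂ e k j →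
    write (write (write (layout A₁ A₂ P P₂) (cell P (# 0)) e) (cell P (# 2)) nothing) (cell P' (# 2)) 𝟙 k j
      ≡ layout (update A₁ P e) A₂ P' P₂ k j
  relayout₁ A₁ A₂ P P' P₂ e k j
    rewrite cell-≟ k P' j (# 2) | cell-≟ k P j (# 2) | cell-≟ k P j (# 0) with j
  ... | zero                   = refl
  ... | suc zero               = refl
  ... | suc (suc zero)         = move-mark k P P'
  ... | suc (suc (suc zero))   = refl

  relayout₂ : ∀ A₁ A₂ P₁ P P' e k j →
    write (write (write (layout A₁ A₂ P₁ P) (cell P (# 1)) e) (cell P (# 3)) nothing) (cell P' (# 3)) 𝟙 k j
      ≡ layout A₁ (update A₂ P e) P₁ P' k j
  relayout₂ A₁ A₂ P₁ P P' e k j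
    rewrite cell-≟ k P' j (# 3) | cell-≟ k P j (# 3) | cell-≟ k P j (# 1) with j
  ... | zero                   = refl
  ... | suc zero               = refl
  ... | suc (suc zero)         = refl
  ... | suc (suc (suc zero))   = move-mark k P P'

-- Case 𝒟 ≠ ∅: the simulator, using the data symbol `marker` as 𝟙.
module Simulator (nA nD nCh : ℕ) (M₁ M₂ : Params.RTM nA nD nCh) (C : Subset nCh) (marker : Fin nD) where
  open Params nA nD nCh
  open Tapes nA nD nCh
  open Layouts nA nD nCh marker
  open JointMoves nA nD nCh M₁ M₂ C

  data Track : Set where
    one two : Track

  other : Track → Track
  other one = two
  other two = one

  -- Rdy: ready to perform a step of the
  -- composition.  I0–I2: initialisation (place both markers).  Sw: switch to
  -- the other track's marker.  TC, TM1–TM3: travel block by block to the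
  -- current track's marker.  U1–U4: write the pending symbol and erase the
  -- marker.  V1–V4: walk to the new block, noting whether the other marker
  -- is passed, and set the marker there.  W1–W3: reread the head symbol, and
  -- either finish or turn to the other track's pending write.
  data Phase : Set where
    Rdy Sw TC TM1 TM2 TM3 U1 U2 U3 U4 V1 V2 V3 V4 W1 W2 W3 I0 I1 I2 : Phase

  -- a write still to be carried out on a track
  Pending : Set
  Pending = Maybe (DBox × Dir)

  record St : Set where
    constructor mk
    field
      s1    : Fin M₁.nStates
      s2    : Fin M₂.nStates
      h1 h2 : DBox      -- the symbols under the two heads
      ge    : Bool      -- head 1 is not to the right of head 2
      cur   : Track
      p1 p2 : Pending
      bit   : Bool      -- scratch: a marker seen while moving
      cX    : Dir       -- scratch: direction of the current move
      pc    : Phase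
  open St

  finPhase : Finite Phase
  finPhase = record { size = 20 ; to = to ; from = lookup all ; from-to = from-to }
    where
    all : Vec Phase 20
    all = Rdy ∷ Sw ∷ TC ∷ TM1 ∷ TM2 ∷ TM3 ∷ U1 ∷ U2 ∷ U3 ∷ U4 ∷
          V1 ∷ V2 ∷ V3 ∷ V4 ∷ W1 ∷ W2 ∷ W3 ∷ I0 ∷ I1 ∷ I2 ∷ []
    to : Phase → Fin 20
    to = λ { Rdy → # 0 ; Sw → # 1 ; TC → # 2 ; TM1 → # 3 ; TM2 → # 4 ; TM3 → # 5 ; U1 → # 6 ; U2 → # 7
           ; U3 → # 8 ; U4 → # 9 ; V1 → # 10 ; V2 → # 11 ; V3 → # 12 ; V4 → # 13 ; W1 → # 14 ; W2 → # 15
           ; W3 → # 16 ; I0 → # 17 ; I1 → # 18 ; I2 → # 19 }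
    from-to : ∀ p → lookup all (to p) ≡ p
    from-to = λ { Rdy → refl ; Sw → refl ; TC → refl ; TM1 → refl ; TM2 → refl ; TM3 → refl ; U1 → refl
                ; U2 → refl ; U3 → refl ; U4 → refl ; V1 → refl ; V2 → refl ; V3 → refl ; V4 → refl
                ; W1 → refl ; W2 → refl ; W3 → refl ; I0 → refl ; I1 → refl ; I2 → refl }

  finSt : Finite St
  finSt = finRetract
    (finProd (finFin M₁.nStates) (finProd (finFin M₂.nStates) (finProd finDBox (finProd finDBox (finProd finBool
      (finProd finTrack (finProd finPending (finProd finPending (finProd finBool (finProd finDir finPhase))))))))))
    (λ (a , b , c , d , e , f , g , h , i , j , k) → mk a b c d e f g h i j k)
    (λ (mk a b c d e f g h i j k) → a , b , c , d , e , f , g , h , i , j , k)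
    (λ _ → refl)
    where
    finTrack : Finite Track
    finTrack = finRetract finBool (λ { false → one ; true → two }) (λ { one → false ; two → true })
                                  (λ { one → refl ; two → refl })
    finPending : Finite Pending
    finPending = finMaybe (finProd finDBox finDir)

  abstract
    NS : ℕ
    NS = Finite.size finSt
    toSt : St → Fin NS
    toSt = Finite.to finSt
    fromSt : Fin NS → St
    fromSt = Finite.from finSt
    from-to : ∀ st → fromSt (toSt st) ≡ st
    from-to = Finite.from-to finSt

  isRdy : Phase → Bool
  isRdy Rdy = true
  isRdy _   = false

  -- from one marker cell to the other one of the same block
  switchDir : Track → Dir
  switchDir one = R
  switchDir two = L

  -- the direction of the current track's head, seen from the other head
  travelDir : Track → Bool → Dir
  travelDir two ge = if ge then R else L
  travelDir one ge = if ge then L else R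

  -- whether the marker of the other track is read in phase V1 (else in V3)
  readV1 : Track → Dir → Bool
  readV1 one R = true
  readV1 two L = true
  readV1 _   _ = false

  -- the order bit after the current head moved in direction X, given the
  -- marker bit read on the way (see order-right₁ … order-left₂)
  newge : Track → Dir → Bool → Bool → Bool
  newge one R g b = g ∧ not b
  newge one L g b = g ∨ b
  newge two R g b = g ∨ b
  newge two L g b = g ∧ not b

  pendingOf : Track → Pending → Pending → Pending
  pendingOf one p q = p
  pendingOf two p q = q

  pendingSym : Pending → DBox → DBox
  pendingSym nothing       d = d
  pendingSym (just (e , _)) _ = e

  pendingDir : Pending → Dir
  pendingDir nothing        = R
  pendingDir (just (_ , X)) = X

  clear₁ : Track → Pending → Pending
  clear₁ one p = nothing
  clear₁ two p = p

  clear₂ : Track → Pending → Pending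
  clear₂ one p = p
  clear₂ two p = nothing

  afterWrite : Pending → Phase
  afterWrite nothing  = Rdy
  afterWrite (just _) = W3

  setH₁ : Track → DBox → DBox → DBox
  setH₁ one d h = d
  setH₁ two d h = h

  setH₂ : Track → DBox → DBox → DBox
  setH₂ one d h = h
  setH₂ two d h = d

  -- The deterministic bookkeeping program: in a non-ready state reading d,
  -- the symbol to write, the direction to move, and the next state.
  nextF : St → DBox → DBox × Dir × St
  nextF (mk a b h g ge c p q bt X Rdy) d = d , R , mk a b h g ge c p q bt X Rdy
  nextF (mk a b h g ge c p q bt X I0) d = 𝟙 , R , mk a b h g ge c p q bt X I1
  nextF (mk a b h g ge c p q bt X I1) d = 𝟙 , L , mk a b h g ge c p q bt X I2
  nextF (mk a b h g ge c p q bt X I2) d = d , L , mk a b h g ge c p q bt X Rdy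
  nextF (mk a b h g ge c p q bt X Sw) d = d , switchDir c , mk a b h g ge (other c) p q bt X TC
  nextF (mk a b h g ge c p q bt X TC) d =
    if isMarked d then (d , L , mk a b h g ge c p q bt X U1) else (d , travelDir c ge , mk a b h g ge c p q bt X TM1)
  nextF (mk a b h g ge c p q bt X TM1) d = d , travelDir c ge , mk a b h g ge c p q bt X TM2
  nextF (mk a b h g ge c p q bt X TM2) d = d , travelDir c ge , mk a b h g ge c p q bt X TM3
  nextF (mk a b h g ge c p q bt X TM3) d = d , travelDir c ge , mk a b h g ge c p q bt X TC
  nextF (mk a b h g ge c p q bt X U1) d = d , L , mk a b h g ge c p q bt X U2
  nextF (mk a b h g ge c p q bt X U2) d =
    pendingSym (pendingOf c p q) d , R ,
    mk a b h g ge c (clear₁ c p) (clear₂ c q) bt (pendingDir (pendingOf c p q)) U3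
  nextF (mk a b h g ge c p q bt X U3) d = d , R , mk a b h g ge c p q bt X U4
  nextF (mk a b h g ge c p q bt X U4) d = nothing , X , mk a b h g ge c p q bt X V1
  nextF (mk a b h g ge c p q bt X V1) d =
    d , X , mk a b h g ge c p q (if readV1 c X then isMarked d else bt) X V2
  nextF (mk a b h g ge c p q bt X V2) d = d , X , mk a b h g ge c p q bt X V3
  nextF (mk a b h g ge c p q bt X V3) d =
    d , X , mk a b h g ge c p q (if readV1 c X then bt else isMarked d) X V4
  nextF (mk a b h g ge c p q bt X V4) d = 𝟙 , L , mk a b h g (newge c X ge bt) c p q bt X W1
  nextF (mk a b h g ge c p q bt X W1) d = d , L , mk a b h g ge c p q bt X W2
  nextF (mk a b h g ge c p q bt X W2) d =
    d , R , mk a b (setH₁ c d h) (setH₂ c d g) ge c p q bt X (afterWrite (pendingOf (other c) p q))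
  nextF (mk a b h g ge c p q bt X W3) d = d , R , mk a b h g ge c p q bt X Sw

  -- the phase that starts realising a move of track t when working on track c
  startFor : Track → Track → Phase
  startFor one one = TC
  startFor two two = TC
  startFor _   _   = Sw

  target : St → Choice → St
  target (mk a b h g ge c p q bt X _) (inj₁ (t₁ , e₁ , X₁)) =
    mk t₁ b h g ge c (just (e₁ , X₁)) q bt X (startFor c one)
  target (mk a b h g ge c p q bt X _) (inj₂ (inj₁ (t₂ , e₂ , X₂))) =
    mk a t₂ h g ge c p (just (e₂ , X₂)) bt X (startFor c two)
  target (mk a b h g ge c p q bt X _) (inj₂ (inj₂ ((t₁ , e₁ , X₁) , (t₂ , e₂ , X₂)))) =
    mk t₁ t₂ h g ge c (just (e₁ , X₁)) (just (e₂ , X₂)) bt X TC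

  SpecB : Bool → St → DBox → Actτ → DBox → Dir → Fin NS → Set
  SpecB true st d a e X t = e ≡ d × X ≡ R × ∃ λ ch → Valid (s1 st) (h1 st) (s2 st) (h2 st) ch a × t ≡ toSt (target st ch)
  SpecB false st d a e X t = a ≡ τ × e ≡ proj₁ (nextF st d) × X ≡ proj₁ (proj₂ (nextF st d)) ×
                             t ≡ toSt (proj₂ (proj₂ (nextF st d)))

  Spec : St → DBox → Actτ → DBox → Dir → Fin NS → Set
  Spec st = SpecB (isRdy (pc st)) st

  _≟Dir_ : (X Y : Dir) → Dec (X ≡ Y)
  L ≟Dir L = yes refl
  L ≟Dir R = no λ ()
  R ≟Dir L = no λ ()
  R ≟Dir R = yes refl

  _≟DBox_ : (x y : DBox) → Dec (x ≡ y)
  _≟DBox_ = MP.≡-dec FP._≟_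

  spec? : ∀ st d a e X t → Dec (Spec st d a e X t)
  spec? st with isRdy (pc st)
  ... | true  = λ d a e X t → (e ≟DBox d) ×-dec ((X ≟Dir R) ×-dec
                  ∃? finChoice (λ ch → valid? (s1 st) (h1 st) (s2 st) (h2 st) ch a ×-dec (t FP.≟ toSt (target st ch))))
  ... | false = λ d a e X t → τ? a ×-dec ((e ≟DBox _) ×-dec ((X ≟Dir _) ×-dec (t FP.≟ _)))

  initSt : St
  initSt = mk M₁.init M₂.init nothing nothing true one nothing nothing false R I0

  finalSt : St → Bool
  finalSt st = isRdy (pc st) ∧ M₁.final (s1 st) ∧ M₂.final (s2 st)

  machine : RTM
  machine = record { nStates = NS ; init = toSt initSt ; final = λ s → finalSt (fromSt s)
                   ; trans = λ s d a e X t → does (spec? (fromSt s) d a e X t) }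

  Cfg : Set
  Cfg = Config machine

  MStep : Cfg → Actτ → Cfg → Set
  MStep = RTMStep machine

  Busy : Cfg → Set
  Busy (s , _) = isRdy (pc (fromSt s)) ≡ false

  BStep : Cfg → Cfg → Set
  BStep c c' = Busy c × MStep c τ c'

  trans-spec : ∀ {s d a e X t} → RTM.trans machine s d a e X t ≡ true → Spec (fromSt s) d a e X t
  trans-spec {s} {d} {a} {e} {X} {t} = does-sound (spec? (fromSt s) d a e X t)

  spec-trans : ∀ {s d a e X t} → Spec (fromSt s) d a e X t → RTM.trans machine s d a e X t ≡ true
  spec-trans {s} {d} {a} {e} {X} {t} = dec-true (spec? (fromSt s) d a e X t)

  bookkeeping : ∀ st st' T e X → isRdy (pc st) ≡ false → nextF st (hd T) ≡ (e , X , st') →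
                BStep (toSt st , T) (toSt st' , mvT X e T)
  bookkeeping st st' T e X busy eq = busy' , rtm-step machine (spec-trans spec)
    where
    busy' : isRdy (pc (fromSt (toSt st))) ≡ false
    busy' rewrite from-to st = busy
    spec : Spec (fromSt (toSt st)) (hd T) τ e X (toSt st')
    spec rewrite from-to st | busy | eq = refl , refl , refl , refl

  record Reach (st : St) (T : Tape) (st' : St) (p' : Pos) (W' : World) : Set where
    constructor reach
    field
      rT    : Tape
      rpath : Star BStep (toSt st , T) (toSt st' , rT)
      rok   : LayAt rT p' W'

  done : ∀ {st T p W} → LayAt T p W → Reach st T st p W
  done {T = T} ok = reach T ε ok

  reach-trans : ∀ {st T st' p' W' st'' p'' W''} → Reach st T st' p' W' →
                (∀ T' → LayAt T' p' W' → Reach st' T' st'' p'' W'') → Reach st T st'' p'' W''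
  reach-trans (reach T' path ok) k with k T' ok
  ... | reach T'' path' ok' = reach T'' (path ◅◅ path') ok'

  stepW : ∀ {st st₁ X e p W T st' p' W'} → isRdy (pc st) ≡ false → nextF st (hd T) ≡ (e , X , st₁) →
          LayAt T p W →
          (∀ T₁ → LayAt T₁ (nextPos X p) (write W (cellP p) e) → Reach st₁ T₁ st' p' W') → Reach st T st' p' W'
  stepW {st} {st₁} {X} {e} {p} {W} {T} busy eq ok k with k (mvT X e T) (layAt-step X e T p W ok)
  ... | reach T' path ok' = reach T' (bookkeeping st st₁ T e X busy eq ◅ path) ok'

  stepS : ∀ {st st₁ X p W T st' p' W'} → isRdy (pc st) ≡ false → nextF st (hd T) ≡ (hd T , X , st₁) →
          LayAt T p W →
          (∀ T₁ → LayAt T₁ (nextPos X p) W → Reach st₁ T₁ st' p' W') → Reach st T st' p' W'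
  stepS {st} {st₁} {X} {p} {W} {T} busy eq (lay ok) k =
    stepW {st} {st₁} {X} {hd T} {p} {W} {T} busy eq (lay ok) (λ T₁ ok₁ → k T₁ (lay (shows-≗ (unlay ok₁) (write-hd ok))))

  stepRd : ∀ {st X p W T st' p' W'} (v : DBox) (st₁ : St) → isRdy (pc st) ≡ false → LayAt T p W →
           W (proj₁ p) (proj₂ p) ≡ v → nextF st v ≡ (v , X , st₁) →
           (∀ T₁ → LayAt T₁ (nextPos X p) W → Reach st₁ T₁ st' p' W') → Reach st T st' p' W'
  stepRd {st} {X} {p} {W} {T} v st₁ busy ok wv eq = stepS {st} {st₁} {X} {p} {W} {T} busy eq' ok
    where
    eq' : nextF st (hd T) ≡ (hd T , X , st₁)
    eq' rewrite trans (layAt-hd p ok) wv = eq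

  markCell : Track → Fin 4
  markCell one = # 2
  markCell two = # 3

  beforeMark : Track → Fin 4
  beforeMark one = # 1
  beforeMark two = # 2

  travel : ∀ q D n b {a b₂ h g ge p p' bt X W T} Pt → travelDir q ge ≡ D → Pt ≡ shiftN D n b →
           (∀ k → W k (markCell q) ≡ mark (does (k ℤP.≟ Pt))) → LayAt T (b , markCell q) W →
           Reach (mk a b₂ h g ge q p p' bt X TC) T (mk a b₂ h g ge q p p' bt X U1) (Pt , beforeMark q) W
  travel q D zero b Pt td refl marks ok =
    stepRd 𝟙 _ refl ok (trans (marks b) (cong mark (dec-true (b ℤP.≟ b) refl))) refl
      λ T₁ ok₁ → done (subst (λ z → LayAt T₁ z _) (found q) ok₁)
    where
    found : ∀ q → nextPos L (b , markCell q) ≡ (b , beforeMark q)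
    found one = refl
    found two = refl
  travel q D (suc n) b {a} {b₂} {h} {g} {ge} {p} {p'} {bt} {X} Pt td eqP marks ok =
    stepRd nothing (mk a b₂ h g ge q p p' bt X TM1) refl ok
      (trans (marks b) (cong mark (dec-false (b ℤP.≟ Pt) (λ e → shiftN-≢ D n b (trans e eqP)))))
      (cong (λ x → nothing , x , _) td) λ T₁ ok₁ →
    stepS refl (cong (λ x → hd T₁ , x , _) td) ok₁ λ T₂ ok₂ →
    stepS refl (cong (λ x → hd T₂ , x , _) td) ok₂ λ T₃ ok₃ →
    stepS refl (cong (λ x → hd T₃ , x , _) td) ok₃ λ T₄ ok₄ →
    travel q D n (shift D b) Pt td eqP marks (subst (λ z → LayAt T₄ z _) (oneBlock D q) ok₄)
    where
    oneBlock : ∀ D q → nextPos D (nextPos D (nextPos D (nextPos D (b , markCell q)))) ≡ (shift D b , markCell q)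
    oneBlock R one = refl
    oneBlock R two = refl
    oneBlock L one = refl
    oneBlock L two = refl

  -- travelling from marker 2's block to head 1, and vice versa; the order bit gives the direction
  travelTo₁ : ∀ {a b₂ h g ge p p' bt X T A₁ A₂ P₁ P₂} → ge ≡ does (P₁ ℤP.≤? P₂) →
    LayAt T (P₂ , # 2) (layout A₁ A₂ P₁ P₂) →
    Reach (mk a b₂ h g ge one p p' bt X TC) T (mk a b₂ h g ge one p p' bt X U1) (P₁ , # 1) (layout A₁ A₂ P₁ P₂)
  travelTo₁ {P₁ = P₁} {P₂ = P₂} geq ok with P₁ ℤP.≤? P₂
  ... | yes le = let (n , _ , P₁≡) = distance P₁ P₂ le in
                 travel one L n P₂ P₁ (cong (λ z → if z then L else R) geq) P₁≡ (λ k → refl) ok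
  ... | no nle = let (n , P₁≡ , _) = distance P₂ P₁ (ℤP.<⇒≤ (ℤP.≰⇒> nle)) in
                 travel one R n P₂ P₁ (cong (λ z → if z then L else R) geq) P₁≡ (λ k → refl) ok

  travelTo₂ : ∀ {a b₂ h g ge p p' bt X T A₁ A₂ P₁ P₂} → ge ≡ does (P₁ ℤP.≤? P₂) →
    LayAt T (P₁ , # 3) (layout A₁ A₂ P₁ P₂) →
    Reach (mk a b₂ h g ge two p p' bt X TC) T (mk a b₂ h g ge two p p' bt X U1) (P₂ , # 2) (layout A₁ A₂ P₁ P₂)
  travelTo₂ {P₁ = P₁} {P₂ = P₂} geq ok with P₁ ℤP.≤? P₂
  ... | yes le = let (n , P₂≡ , _) = distance P₁ P₂ le in
                 travel two R n P₁ P₂ (cong (λ z → if z then R else L) geq) P₂≡ (λ k → refl) ok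
  ... | no nle = let (n , _ , P₂≡) = distance P₂ P₁ (ℤP.<⇒≤ (ℤP.≰⇒> nle)) in
                 travel two L n P₁ P₂ (cong (λ z → if z then R else L) geq) P₂≡ (λ k → refl) ok

  -- Realising a pending write (e, D) on track 1 or 2, starting in phase U1
  -- on the cell before the track's marker: write e, erase the marker, walk
  -- one block in direction D noting the other marker, set the marker, and
  -- reread the head symbol.  Each run is fully determined.
  module _ {a : Fin M₁.nStates} {b : Fin M₂.nStates} {h g : DBox} {ge bt : Bool} {X : Dir} {T : Tape}
           (A₁ A₂ : ℤ → DBox) where

    write₁R : ∀ {q} P P₂ e → LayAt T (P , # 1) (layout A₁ A₂ P P₂) →
      Reach (mk a b h g ge one (just (e , R)) q bt X U1) T
            (mk a b (update A₁ P e (P ℤ.+ + 1)) g (ge ∧ not (isMarked (mark (does (P ℤP.≟ P₂))))) one nothing q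
                (isMarked (mark (does (P ℤP.≟ P₂)))) R (afterWrite q))
            (P ℤ.+ + 1 , # 1) (layout (update A₁ P e) A₂ (P ℤ.+ + 1) P₂)
    write₁R P P₂ e ok =
      stepS refl refl ok λ T₁ ok₁ → stepW refl refl ok₁ λ T₂ ok₂ →
      stepS refl refl ok₂ λ T₃ ok₃ → stepW refl refl ok₃ λ T₄ ok₄ →
      stepRd _ _ refl ok₄ (trans (write-cell W₁ P (# 2) nothing P (# 3)) (write-cell W₀ P (# 0) e P (# 3))) refl λ T₅ ok₅ →
      stepS refl refl ok₅ λ T₆ ok₆ → stepS refl refl ok₆ λ T₇ ok₇ →
      stepW refl refl ok₇ λ T₈ ok₈ → stepS refl refl ok₈ λ T₉ ok₉ →
      stepRd _ _ refl ok₉ (relayout₁ A₁ A₂ P (P ℤ.+ + 1) P₂ e (P ℤ.+ + 1) (# 0)) refl λ T₁₀ ok₁₀ →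
      done (lay (shows-≗ (unlay ok₁₀) (relayout₁ A₁ A₂ P (P ℤ.+ + 1) P₂ e)))
      where
      W₀ W₁ : World
      W₀ = layout A₁ A₂ P P₂
      W₁ = write W₀ (cell P (# 0)) e

    write₁L : ∀ {q} P P₂ e → LayAt T (P , # 1) (layout A₁ A₂ P P₂) →
      Reach (mk a b h g ge one (just (e , L)) q bt X U1) T
            (mk a b (update A₁ P e (P ℤ.- + 1)) g (ge ∨ isMarked (mark (does (P ℤ.- + 1 ℤP.≟ P₂)))) one nothing q
                (isMarked (mark (does (P ℤ.- + 1 ℤP.≟ P₂)))) L (afterWrite q))
            (P ℤ.- + 1 , # 1) (layout (update A₁ P e) A₂ (P ℤ.- + 1) P₂)
    write₁L P P₂ e ok =
      stepS refl refl ok λ T₁ ok₁ → stepW refl refl ok₁ λ T₂ ok₂ →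
      stepS refl refl ok₂ λ T₃ ok₃ → stepW refl refl ok₃ λ T₄ ok₄ →
      stepS refl refl ok₄ λ T₅ ok₅ → stepS refl refl ok₅ λ T₆ ok₆ →
      stepRd _ _ refl ok₆ (trans (write-cell W₁ P (# 2) nothing (P ℤ.- + 1) (# 3))
                                 (write-cell W₀ P (# 0) e (P ℤ.- + 1) (# 3))) refl λ T₇ ok₇ →
      stepW refl refl ok₇ λ T₈ ok₈ → stepS refl refl ok₈ λ T₉ ok₉ →
      stepRd _ _ refl ok₉ (relayout₁ A₁ A₂ P (P ℤ.- + 1) P₂ e (P ℤ.- + 1) (# 0)) refl λ T₁₀ ok₁₀ →
      done (lay (shows-≗ (unlay ok₁₀) (relayout₁ A₁ A₂ P (P ℤ.- + 1) P₂ e)))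
      where
      W₀ W₁ : World
      W₀ = layout A₁ A₂ P P₂
      W₁ = write W₀ (cell P (# 0)) e

    write₂R : ∀ {p} P₁ P e → LayAt T (P , # 2) (layout A₁ A₂ P₁ P) →
      Reach (mk a b h g ge two p (just (e , R)) bt X U1) T
            (mk a b h (update A₂ P e (P ℤ.+ + 1)) (ge ∨ isMarked (mark (does (P ℤ.+ + 1 ℤP.≟ P₁)))) two p nothing
                (isMarked (mark (does (P ℤ.+ + 1 ℤP.≟ P₁)))) R (afterWrite p))
            (P ℤ.+ + 1 , # 2) (layout A₁ (update A₂ P e) P₁ (P ℤ.+ + 1))
    write₂R P₁ P e ok =
      stepS refl refl ok λ T₁ ok₁ → stepW refl refl ok₁ λ T₂ ok₂ →
      stepS refl refl ok₂ λ T₃ ok₃ → stepW refl refl ok₃ λ T₄ ok₄ →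
      stepS refl refl ok₄ λ T₅ ok₅ → stepS refl refl ok₅ λ T₆ ok₆ →
      stepRd _ _ refl ok₆ (trans (write-cell W₁ P (# 3) nothing (P ℤ.+ + 1) (# 2))
                                 (write-cell W₀ P (# 1) e (P ℤ.+ + 1) (# 2))) refl λ T₇ ok₇ →
      stepW refl refl ok₇ λ T₈ ok₈ → stepS refl refl ok₈ λ T₉ ok₉ →
      stepRd _ _ refl ok₉ (relayout₂ A₁ A₂ P₁ P (P ℤ.+ + 1) e (P ℤ.+ + 1) (# 1)) refl λ T₁₀ ok₁₀ →
      done (lay (shows-≗ (unlay ok₁₀) (relayout₂ A₁ A₂ P₁ P (P ℤ.+ + 1) e)))
      where
      W₀ W₁ : World
      W₀ = layout A₁ A₂ P₁ P
      W₁ = write W₀ (cell P (# 1)) e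

    write₂L : ∀ {p} P₁ P e → LayAt T (P , # 2) (layout A₁ A₂ P₁ P) →
      Reach (mk a b h g ge two p (just (e , L)) bt X U1) T
            (mk a b h (update A₂ P e (P ℤ.- + 1)) (ge ∧ not (isMarked (mark (does (P ℤP.≟ P₁))))) two p nothing
                (isMarked (mark (does (P ℤP.≟ P₁)))) L (afterWrite p))
            (P ℤ.- + 1 , # 2) (layout A₁ (update A₂ P e) P₁ (P ℤ.- + 1))
    write₂L P₁ P e ok =
      stepS refl refl ok λ T₁ ok₁ → stepW refl refl ok₁ λ T₂ ok₂ →
      stepS refl refl ok₂ λ T₃ ok₃ → stepW refl refl ok₃ λ T₄ ok₄ →
      stepRd _ _ refl ok₄ (trans (write-cell W₁ P (# 3) nothing P (# 2)) (write-cell W₀ P (# 1) e P (# 2))) refl λ T₅ ok₅ →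
      stepS refl refl ok₅ λ T₆ ok₆ → stepS refl refl ok₆ λ T₇ ok₇ →
      stepW refl refl ok₇ λ T₈ ok₈ → stepS refl refl ok₈ λ T₉ ok₉ →
      stepRd _ _ refl ok₉ (relayout₂ A₁ A₂ P₁ P (P ℤ.- + 1) e (P ℤ.- + 1) (# 1)) refl λ T₁₀ ok₁₀ →
      done (lay (shows-≗ (unlay ok₁₀) (relayout₂ A₁ A₂ P₁ P (P ℤ.- + 1) e)))
      where
      W₀ W₁ : World
      W₀ = layout A₁ A₂ P₁ P
      W₁ = write W₀ (cell P (# 1)) e

  update₁ : ∀ {a b h g ge q bt X} A₁ A₂ P₁ P₂ e D → ge ≡ does (P₁ ℤP.≤? P₂) →
    Σ Bool λ bt' → ∀ T → LayAt T (P₁ , # 1) (layout A₁ A₂ P₁ P₂) →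
    Reach (mk a b h g ge one (just (e , D)) q bt X U1) T
          (mk a b (update A₁ P₁ e (shift D P₁)) g (does (shift D P₁ ℤP.≤? P₂)) one nothing q bt' D (afterWrite q))
          (shift D P₁ , # 1) (layout (update A₁ P₁ e) A₂ (shift D P₁) P₂)
  update₁ {ge = ge} A₁ A₂ P₁ P₂ e R geq =
    _ , λ T ok → subst (λ g' → Reach _ T (mk _ _ _ _ g' _ _ _ _ _ _) _ _) order (write₁R A₁ A₂ P₁ P₂ e ok)
    where order : ge ∧ not (isMarked (mark (does (P₁ ℤP.≟ P₂)))) ≡ does (P₁ ℤ.+ + 1 ℤP.≤? P₂)
          order rewrite geq | isMarked-mark (does (P₁ ℤP.≟ P₂)) = order-right₁ P₁ P₂
  update₁ {ge = ge} A₁ A₂ P₁ P₂ e L geq =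
    _ , λ T ok → subst (λ g' → Reach _ T (mk _ _ _ _ g' _ _ _ _ _ _) _ _) order (write₁L A₁ A₂ P₁ P₂ e ok)
    where order : ge ∨ isMarked (mark (does (P₁ ℤ.- + 1 ℤP.≟ P₂))) ≡ does (P₁ ℤ.- + 1 ℤP.≤? P₂)
          order rewrite geq | isMarked-mark (does (P₁ ℤ.- + 1 ℤP.≟ P₂)) = order-left₁ P₁ P₂

  update₂ : ∀ {a b h g ge p bt X} A₁ A₂ P₁ P₂ e D → ge ≡ does (P₁ ℤP.≤? P₂) →
    Σ Bool λ bt' → ∀ T → LayAt T (P₂ , # 2) (layout A₁ A₂ P₁ P₂) →
    Reach (mk a b h g ge two p (just (e , D)) bt X U1) T
          (mk a b h (update A₂ P₂ e (shift D P₂)) (does (P₁ ℤP.≤? shift D P₂)) two p nothing bt' D (afterWrite p))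
          (shift D P₂ , # 2) (layout A₁ (update A₂ P₂ e) P₁ (shift D P₂))
  update₂ {ge = ge} A₁ A₂ P₁ P₂ e R geq =
    _ , λ T ok → subst (λ g' → Reach _ T (mk _ _ _ _ g' _ _ _ _ _ _) _ _) order (write₂R A₁ A₂ P₁ P₂ e ok)
    where order : ge ∨ isMarked (mark (does (P₂ ℤ.+ + 1 ℤP.≟ P₁))) ≡ does (P₁ ℤP.≤? P₂ ℤ.+ + 1)
          order rewrite geq | isMarked-mark (does (P₂ ℤ.+ + 1 ℤP.≟ P₁)) = order-right₂ P₁ P₂
  update₂ {ge = ge} A₁ A₂ P₁ P₂ e L geq =
    _ , λ T ok → subst (λ g' → Reach _ T (mk _ _ _ _ g' _ _ _ _ _ _) _ _) order (write₂L A₁ A₂ P₁ P₂ e ok)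
    where order : ge ∧ not (isMarked (mark (does (P₂ ℤP.≟ P₁)))) ≡ does (P₁ ℤP.≤? P₂ ℤ.- + 1)
          order rewrite geq | isMarked-mark (does (P₂ ℤP.≟ P₁)) = order-left₂ P₁ P₂

  -- in a ready state the head rests on the cell before the current track's marker
  restPos : Track → ℤ → ℤ → Pos
  restPos one P₁ P₂ = P₁ , # 1
  restPos two P₁ P₂ = P₂ , # 2

  record Encodes (s : Fin NS) (T : Tape) (q₁ : Fin M₁.nStates) (T₁ : Tape) (q₂ : Fin M₂.nStates) (T₂ : Tape) : Set where
    field
      eh₁ eh₂ : DBox
      ege     : Bool
      ecur    : Track
      ebit    : Bool
      eX      : Dir
      A₁ A₂   : ℤ → DBox
      P₁ P₂   : ℤ
      st≡     : fromSt s ≡ mk q₁ q₂ eh₁ eh₂ ege ecur nothing nothing ebit eX Rdy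
      h₁≡     : eh₁ ≡ A₁ P₁
      h₂≡     : eh₂ ≡ A₂ P₂
      ge≡     : ege ≡ does (P₁ ℤP.≤? P₂)
      elay    : LayAt T (restPos ecur P₁ P₂) (layout A₁ A₂ P₁ P₂)
      rep₁    : Rep T₁ A₁ P₁
      rep₂    : Rep T₂ A₂ P₂

  Enc : Cfg → ParSt → Set
  Enc (s , T) ((q₁ , T₁) , (q₂ , T₂)) = Encodes s T q₁ T₁ q₂ T₂

  Rel : Cfg → ParSt → Set
  Rel m p = Σ Cfg λ m' → Star BStep m m' × Enc m' p

  toRel : ∀ {st T q₁ q₂ h₁ h₂ ge c bt X P₁ P₂ A₁ A₂ T₁ T₂} →
    Reach st T (mk q₁ q₂ h₁ h₂ ge c nothing nothing bt X Rdy) (restPos c P₁ P₂) (layout A₁ A₂ P₁ P₂) →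
    h₁ ≡ A₁ P₁ → h₂ ≡ A₂ P₂ → ge ≡ does (P₁ ℤP.≤? P₂) → Rep T₁ A₁ P₁ → Rep T₂ A₂ P₂ →
    Rel (toSt st , T) ((q₁ , T₁) , (q₂ , T₂))
  toRel (reach T' path ok) e₁ e₂ e₃ r₁ r₂ =
    (toSt _ , T') , path , record { st≡ = from-to _ ; h₁≡ = e₁ ; h₂≡ = e₂ ; ge≡ = e₃ ; elay = ok ; rep₁ = r₁ ; rep₂ = r₂ }

  toTrack₁ : ∀ c {a b h g ge p p' bt X T A₁ A₂ P₁ P₂} → ge ≡ does (P₁ ℤP.≤? P₂) →
    LayAt T (nextPos R (restPos c P₁ P₂)) (layout A₁ A₂ P₁ P₂) →
    Reach (mk a b h g ge c p p' bt X (startFor c one)) T (mk a b h g ge one p p' bt X U1) (P₁ , # 1) (layout A₁ A₂ P₁ P₂)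
  toTrack₁ one {P₁ = P₁} geq ok = travel one _ 0 P₁ P₁ refl refl (λ k → refl) ok
  toTrack₁ two geq ok = stepS refl refl ok λ T' ok' → travelTo₁ geq ok'

  toTrack₂ : ∀ c {a b h g ge p p' bt X T A₁ A₂ P₁ P₂} → ge ≡ does (P₁ ℤP.≤? P₂) →
    LayAt T (nextPos R (restPos c P₁ P₂)) (layout A₁ A₂ P₁ P₂) →
    Reach (mk a b h g ge c p p' bt X (startFor c two)) T (mk a b h g ge two p p' bt X U1) (P₂ , # 2) (layout A₁ A₂ P₁ P₂)
  toTrack₂ two {P₂ = P₂} geq ok = travel two _ 0 P₂ P₂ refl refl (λ k → refl) ok
  toTrack₂ one geq ok = stepS refl refl ok λ T' ok' → travelTo₂ geq ok'

  switch₁₂ : ∀ {a b h g ge p p' bt X T A₁ A₂ P₁ P₂} → ge ≡ does (P₁ ℤP.≤? P₂) →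
    LayAt T (P₁ , # 1) (layout A₁ A₂ P₁ P₂) →
    Reach (mk a b h g ge one p p' bt X W3) T (mk a b h g ge two p p' bt X U1) (P₂ , # 2) (layout A₁ A₂ P₁ P₂)
  switch₁₂ geq ok = stepS refl refl ok λ T₁ ok₁ → stepS refl refl ok₁ λ T₂ ok₂ → travelTo₂ geq ok₂

  switch₂₁ : ∀ {a b h g ge p p' bt X T A₁ A₂ P₁ P₂} → ge ≡ does (P₁ ℤP.≤? P₂) →
    LayAt T (P₂ , # 2) (layout A₁ A₂ P₁ P₂) →
    Reach (mk a b h g ge two p p' bt X W3) T (mk a b h g ge one p p' bt X U1) (P₁ , # 1) (layout A₁ A₂ P₁ P₂)
  switch₂₁ geq ok = stepS refl refl ok λ T₁ ok₁ → stepS refl refl ok₁ λ T₂ ok₂ → travelTo₁ geq ok₂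

  runAfter : ∀ ch {q₁ q₂ h₁ h₂ ge c bt X T A₁ A₂ P₁ P₂ T₁ T₂} →
    h₁ ≡ A₁ P₁ → h₂ ≡ A₂ P₂ → ge ≡ does (P₁ ℤP.≤? P₂) →
    LayAt T (nextPos R (restPos c P₁ P₂)) (layout A₁ A₂ P₁ P₂) → Rep T₁ A₁ P₁ → Rep T₂ A₂ P₂ →
    Rel (toSt (target (mk q₁ q₂ h₁ h₂ ge c nothing nothing bt X Rdy) ch) , T) (perform ch ((q₁ , T₁) , (q₂ , T₂)))
  runAfter (inj₁ (t₁ , e₁ , D₁)) {c = c} {A₁ = A₁} {A₂} {P₁} {P₂} {T₁} _ h₂≡ geq ok r₁ r₂ =
    toRel (reach-trans (toTrack₁ c geq ok) (proj₂ (update₁ A₁ A₂ P₁ P₂ e₁ D₁ geq)))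
          refl h₂≡ refl (rep-mvT D₁ e₁ T₁ A₁ P₁ r₁) r₂
  runAfter (inj₂ (inj₁ (t₂ , e₂ , D₂))) {c = c} {A₁ = A₁} {A₂} {P₁} {P₂} {T₂ = T₂} h₁≡ _ geq ok r₁ r₂ =
    toRel (reach-trans (toTrack₂ c geq ok) (proj₂ (update₂ A₁ A₂ P₁ P₂ e₂ D₂ geq)))
          h₁≡ refl refl r₁ (rep-mvT D₂ e₂ T₂ A₂ P₂ r₂)
  runAfter (inj₂ (inj₂ ((t₁ , e₁ , D₁) , (t₂ , e₂ , D₂)))) {c = one} {A₁ = A₁} {A₂} {P₁} {P₂} {T₁} {T₂}
           _ _ geq ok r₁ r₂ =
    toRel (reach-trans (toTrack₁ one geq ok) λ T' ok' →
           reach-trans (proj₂ (update₁ A₁ A₂ P₁ P₂ e₁ D₁ geq) T' ok') λ T'' ok'' →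
           reach-trans (switch₁₂ refl ok'') (proj₂ (update₂ (update A₁ P₁ e₁) A₂ (shift D₁ P₁) P₂ e₂ D₂ refl)))
          refl refl refl (rep-mvT D₁ e₁ T₁ A₁ P₁ r₁) (rep-mvT D₂ e₂ T₂ A₂ P₂ r₂)
  runAfter (inj₂ (inj₂ ((t₁ , e₁ , D₁) , (t₂ , e₂ , D₂)))) {c = two} {A₁ = A₁} {A₂} {P₁} {P₂} {T₁} {T₂}
           _ _ geq ok r₁ r₂ =
    toRel (reach-trans (toTrack₂ two geq ok) λ T' ok' →
           reach-trans (proj₂ (update₂ A₁ A₂ P₁ P₂ e₂ D₂ geq) T' ok') λ T'' ok'' →
           reach-trans (switch₂₁ refl ok'') (proj₂ (update₁ A₁ (update A₂ P₂ e₂) P₁ (shift D₂ P₂) e₁ D₁ refl)))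
          refl refl refl (rep-mvT D₁ e₁ T₁ A₁ P₁ r₁) (rep-mvT D₂ e₂ T₂ A₂ P₂ r₂)

module Bisimulation (nA nD nCh : ℕ) (M₁ M₂ : Params.RTM nA nD nCh) (C : Subset nCh) (marker : Fin nD) where
  open Params nA nD nCh
  open Tapes nA nD nCh
  open Layouts nA nD nCh marker
  open JointMoves nA nD nCh M₁ M₂ C
  open Simulator nA nD nCh M₁ M₂ C marker
  open St

  heads : ∀ {s T q₁ T₁ q₂ T₂} (enc : Encodes s T q₁ T₁ q₂ T₂) → Encodes.eh₁ enc ≡ hd T₁ × Encodes.eh₂ enc ≡ hd T₂
  heads enc = trans h₁≡ (sym (hd-rep rep₁)) , trans h₂≡ (sym (hd-rep rep₂))
    where open Encodes enc

  ready⇒par : ∀ {s T q₁ T₁ q₂ T₂ a s' T'} → Encodes s T q₁ T₁ q₂ T₂ → MStep (s , T) a (s' , T') →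
    Σ ParSt λ p' → PStep ((q₁ , T₁) , (q₂ , T₂)) a p' × Rel (s' , T') p'
  ready⇒par {s} {T} {q₁} {T₁} {q₂} {T₂} {a} {s'} enc st with rtm-step⁻¹ machine st
  ... | e , X , tr , refl with subst (λ z → Spec z (hd T) a e X s') (Encodes.st≡ enc) (trans-spec tr)
  ... | refl , refl , ch , v , refl =
    _ , valid⇒step ch a (subst₂ (λ x y → Valid q₁ x q₂ y ch a) (proj₁ (heads enc)) (proj₂ (heads enc)) v) ,
    runAfter ch (Encodes.h₁≡ enc) (Encodes.h₂≡ enc) (Encodes.ge≡ enc) (layAt-move R (Encodes.elay enc))
             (Encodes.rep₁ enc) (Encodes.rep₂ enc)

  par⇒ready : ∀ {s T q₁ T₁ q₂ T₂ a p'} → Encodes s T q₁ T₁ q₂ T₂ → PStep ((q₁ , T₁) , (q₂ , T₂)) a p' →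
    Σ Cfg λ m' → MStep (s , T) a m' × Rel m' p'
  par⇒ready {s} {T} {q₁} {T₁} {q₂} {T₂} {a} enc pst with step⇒valid pst
  ... | ch , v , refl = _ , rtm-step machine (spec-trans spec) , runAfter ch h₁≡ h₂≡ ge≡ (layAt-move R elay) rep₁ rep₂
    where
    open Encodes enc
    spec : Spec (fromSt s) (hd T) a (hd T) R (toSt (target (mk q₁ q₂ eh₁ eh₂ ege ecur nothing nothing ebit eX Rdy) ch))
    spec rewrite st≡ =
      refl , refl , ch , subst₂ (λ x y → Valid q₁ x q₂ y ch a) (sym (proj₁ (heads enc))) (sym (proj₂ (heads enc))) v , refl

  busy-deterministic : ∀ {s T a s' T' s'' T''} → Busy (s , T) → MStep (s , T) a (s' , T') → MStep (s , T) τ (s'' , T'') →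
                       a ≡ τ × (s' , T') ≡ (s'' , T'')
  busy-deterministic {s} {T} busy st₁ st₂ with rtm-step⁻¹ machine st₁ | rtm-step⁻¹ machine st₂
  ... | e , X , tr , refl | e' , X' , tr' , refl with asBusy tr | asBusy tr'
    where
    asBusy : ∀ {a e X t} → RTM.trans machine s (hd T) a e X t ≡ true → SpecB false (fromSt s) (hd T) a e X t
    asBusy {a} {e} {X} {t} tr = subst (λ b → SpecB b (fromSt s) (hd T) a e X t) busy (trans-spec tr)
  ... | refl , refl , refl , refl | refl , refl , refl , refl = refl , refl

  initial : Rel (toSt initSt , emptyTape) ((M₁.init , emptyTape) , (M₂.init , emptyTape))
  initial = toRel run refl refl refl (λ x → val-empty (x ℤ.- +0)) (λ x → val-empty (x ℤ.- +0))
    where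
    blank : World
    blank _ _ = nothing
    marked : ∀ k j → write (write blank (cell +0 (# 2)) 𝟙) (cell +0 (# 3)) 𝟙 k j ≡ layout (λ _ → nothing) (λ _ → nothing) +0 +0 k j
    marked k j rewrite cell-≟ k +0 j (# 3) | cell-≟ k +0 j (# 2) with j
    ... | zero                 = refl
    ... | suc zero             = refl
    ... | suc (suc zero)       = if-mark (does (k ℤP.≟ +0))
    ... | suc (suc (suc zero)) = if-mark (does (k ℤP.≟ +0))
    start : LayAt emptyTape (+0 , # 2) blank
    start = lay (λ k j → val-empty (cell k j ℤ.- cell +0 (# 2)))
    run : Reach initSt emptyTape (mk M₁.init M₂.init nothing nothing true one nothing nothing false R Rdy)
                (+0 , # 1) (layout (λ _ → nothing) (λ _ → nothing) +0 +0)
    run = stepW refl refl start λ T₁ ok₁ →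
          stepW refl refl ok₁ λ T₂ ok₂ →
          stepS refl refl ok₂ λ T₃ ok₃ →
          done (lay (shows-≗ (unlay ok₃) marked))

  TM TP : TS
  TM = 𝒯 machine
  TP = 𝒯Par C M₁ M₂

  bookkeeping-τ : ∀ {x y} → Star BStep x y → Star (λ a b → MStep a τ b) x y
  bookkeeping-τ ε = ε
  bookkeeping-τ ((_ , st) ◅ rest) = st ◅ bookkeeping-τ rest

  star-then : ∀ {A : Set} {_~_ : A → A → Set} {x y z} → Star _~_ x y → y ~ z → TransClosure _~_ x z
  star-then ε r = [ r ]
  star-then (r ◅ rs) r' = r ∷ star-then rs r'

  -- an infinite τ-run from a related configuration must pass the ready state
  -- at the end of the bookkeeping, where the composition takes the same step
  diverges : ∀ {m m' p} → Star BStep m m' → Enc m' p → (f : ℕ → Cfg) → f zero ≡ m →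
             (∀ i → MStep (f i) τ (f (suc i))) →
             Σ ParSt λ p' → TransClosure (λ x y → PStep x τ y) p p' × Σ ℕ λ i → Rel (f i) p'
  diverges ε enc f refl steps with ready⇒par enc (steps 0)
  ... | p' , pst , rel = p' , [ pst ] , 1 , rel
  diverges ((busy , st) ◅ rest) enc f refl steps with busy-deterministic busy (steps 0) st
  ... | _ , e with diverges rest enc (λ i → f (suc i)) e (λ i → steps (suc i))
  ...   | p' , pl , i , rel = p' , pl , suc i , rel

  forth : HalfBisim TM TP Rel
  forth = record { step = step ; final = λ {m} {p} → final {m} {p} ; diverge = diverge }
    where
    step : ∀ {m p a m'} → Rel m p → MStep m a m' →
           ∃ λ p'' → ∃ λ p' → _↠₂_ TM TP p p'' × _⟶₂⟨_⟩_ TM TP p'' a p' × Rel m p'' × Rel m' p'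
    step {p = p} (m' , ε , enc) st with ready⇒par enc st
    ... | p' , pst , rel = p , p' , ε , inj₁ pst , (m' , ε , enc) , rel
    -- a bookkeeping step is inert: the composition stays put
    step {p = p} (m' , (busy , bst) ◅ rest , enc) st with busy-deterministic busy st bst
    ... | refl , refl = p , p , ε , inj₂ (refl , refl) , (m' , (busy , bst) ◅ rest , enc) , (m' , rest , enc)
    final : ∀ {m p} → Rel m p → TS.Final TM m → ∃ λ p' → _↠₂_ TM TP p p' × TS.Final TP p' × Rel m p'
    final {s , T} {p} (m' , ε , enc) fin with subst (λ z → finalSt z ≡ true) (Encodes.st≡ enc) fin
    ... | fin' = p , ε , (BP.∧-conicalˡ _ _ fin' , BP.∧-conicalʳ _ _ fin') , (m' , ε , enc)
    -- a busy configuration is never final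
    final {s , T} {p} (m' , (busy , _) ◅ _ , _) fin
      with subst (λ b → b ∧ (M₁.final (s1 (fromSt s)) ∧ M₂.final (s2 (fromSt s))) ≡ true) busy fin
    ... | ()
    diverge : ∀ {m p} → Rel m p → (f : ℕ → Cfg) → f zero ≡ m → (∀ i → MStep (f i) τ (f (suc i))) →
              (∀ i → Rel (f i) p) → ∃ λ p' → _↠⁺₂_ TM TP p p' × ∃ λ i → Rel (f i) p'
    diverge (m' , path , enc) f f0 steps _ = diverges path enc f f0 steps

  back : HalfBisim TP TM (flipR Rel)
  back = record { step = step ; final = λ {p} {m} → final {p} {m} ; diverge = diverge }
    where
    step : ∀ {p m a p'} → Rel m p → PStep p a p' →
           ∃ λ m'' → ∃ λ m' → _↠₂_ TP TM m m'' × _⟶₂⟨_⟩_ TP TM m'' a m' × Rel m'' p × Rel m' p'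
    step (m' , path , enc) pst with par⇒ready enc pst
    ... | m'' , st , rel = m' , m'' , bookkeeping-τ path , inj₁ st , (m' , ε , enc) , rel
    final : ∀ {p m} → Rel m p → TS.Final TP p → ∃ λ m' → _↠₂_ TP TM m m' × TS.Final TM m' × Rel m' p
    final ((s , T) , path , enc) (f₁ , f₂) = (s , T) , bookkeeping-τ path , fin , ((s , T) , ε , enc)
      where
      fin : finalSt (fromSt s) ≡ true
      fin rewrite Encodes.st≡ enc | f₁ | f₂ = refl
    diverge : ∀ {p m} → Rel m p → (f : ℕ → ParSt) → f zero ≡ p → (∀ i → PStep (f i) τ (f (suc i))) →
              (∀ i → Rel m (f i)) → ∃ λ m' → _↠⁺₂_ TP TM m m' × ∃ λ i → Rel m' (f i)
    diverge (m' , path , enc) f refl steps _ with par⇒ready enc (steps 0)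
    ... | m'' , st , rel = m'' , star-then (bookkeeping-τ path) st , 1 , rel

  simulates : TM ↔bΔ TP
  simulates = Rel , record { forth = forth ; back = back } , initial

corollary3 : (nA nD nCh : ℕ) → (M₁ M₂ : Params.RTM nA nD nCh) → (C : Subset nCh) →
    Σ (Params.RTM nA nD nCh) λ M →
      Params._↔bΔ_ nA nD nCh (Params.𝒯 nA nD nCh M) (Params.𝒯Par nA nD nCh C M₁ M₂)
corollary3 nA zero     nCh M₁ M₂ C = BlankTapes.Product nA nCh M₁ M₂ C , BlankTapes.simulates nA nCh M₁ M₂ C
corollary3 nA (suc nD) nCh M₁ M₂ C =
  Simulator.machine nA (suc nD) nCh M₁ M₂ C zero , Bisimulation.simulates nA (suc nD) nCh M₁ M₂ C zero
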